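{- Let $\mathbb{F}$ be a field, $u:Y\to X$ a degree-$m$ covering of connected simplicial complexes, and suppose $\mathrm{char}\,\mathbb{F}\nmid m$. Define $\varphi:u_*\mathbb{F}_Y\to\mathbb{F}_X$ by $\varphi_x((\alpha_y)_{y\in u^{ -1}(x)})=\sum_y\alpha_y$ for every nonempty face $x$, and let $\mathcal{G}=\ker\varphi$. Then $h^0(\mathcal{G})=0$ and $h^1(\mathcal{G})=\dim H^1(Y,\mathbb{F})-\dim H^1(X,\mathbb{F})$.
   Context: A covering $u:Y\to X$ is a surjective simplicial map inducing, for each vertex $y$, a bijection from faces containing $y$ to faces containing $u(y)$; degree $m$ means every nonempty face of $X$ has exactly $m$ preimages. $\mathbb{F}_Z$ is the constant sheaf on $Z$: $\mathbb{F}$ on every nonempty face with identity restriction maps. Pushforward along the (dimension-preserving) covering: $u_*\mathcal{H}(x)=\prod_{y\in u^{ -1}(x)}\mathcal{H}(y)$, with restriction for $x\subsetneq x'$ sending $(f_y)_y$ to $(\mathrm{res}_{y'\leftarrow y'(x)}f_{y'(x)})_{y'\in u^{ -1}(x')}$, $y'(x)$ the face of $y'$ over $x$. $\ker\varphi$ is the subsheaf of facewise kernels. $h^i(\mathcal{G})=\dim_{\mathbb{F}}H^i(X,\mathcal{G})$, sheaf cohomology computed by alternating cochains over ordered faces with signed coboundary (with $C^{ -1}=0$); $H^i(Z,\mathbb{F})=H^i(Z,\mathbb{F}_Z)$. -}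

module Defs where

open import Level using (Level; _⊔_) renaming (suc to lsuc)
open import Data.Nat using (ℕ; zero; suc; _<_)
open import Data.Bool using (Bool; true; false; T; _∧_; if_then_else_)
import Data.Bool as Bool
open import Data.Fin using (Fin)
import Data.Fin as Fin
open import Data.Fin.Properties using (any?) renaming (_<?_ to _<ᶠ?_)
open import Data.Fin.Subset using (Subset; inside; outside; _∈_; _⊆_; ⁅_⁆; _∪_; _∩_; ∣_∣; Nonempty)
open import Data.Fin.Subset.Properties using (_∈?_)
import Data.Fin.Subset as Sub
open import Data.Vec using (Vec; []; _∷_; tabulate; lookup)
open import Data.Vec.Properties using (≡-dec)
open import Data.Product using (Σ; _×_; _,_; ∃; curry)
open import Data.Unit using (⊤; tt)
open import Relation.Nullary using (¬_; _×-dec_)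
open import Relation.Nullary.Decidable using (⌊_⌋)
open import Relation.Binary.PropositionalEquality using (_≡_)
open import Algebra.Bundles using (CommutativeRing)
open import Function using (Injective)

record Field (c ℓ : Level) : Set (lsuc (c ⊔ ℓ)) where
  field
    commutativeRing : CommutativeRing c ℓ
  open CommutativeRing commutativeRing public
  field
    0≉1     : ¬ (0# ≈ 1#)
    inverse : ∀ x → ¬ (x ≈ 0#) → Σ Carrier λ y → (x * y) ≈ 1#

record SimplicialComplex : Set where
  field
    n         : ℕ
    isFace    : Subset n → Bool
    nonempty  : ∀ σ → T (isFace σ) → Nonempty σ
    downward  : ∀ σ τ → T (isFace τ) → σ ⊆ τ → Nonempty σ → T (isFace σ)
    vertices  : ∀ v → T (isFace ⁅ v ⁆)

open SimplicialComplex public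

data Reach (K : SimplicialComplex) : Fin (n K) → Fin (n K) → Set where
  here : ∀ v → Reach K v v
  step : ∀ u v w → T (isFace K (⁅ u ⁆ ∪ ⁅ v ⁆)) → Reach K v w → Reach K u w

Connected : SimplicialComplex → Set
Connected K = (0 < n K) × (∀ v w → Reach K v w)

image : ∀ {a b} → (Fin a → Fin b) → Subset a → Subset b
image f σ = tabulate λ x → ⌊ any? (λ y → (y ∈? σ) ×-dec (f y Data.Fin.≟ x)) ⌋

preimage : ∀ {a b} → (Fin a → Fin b) → Subset b → Subset a
preimage f x = tabulate λ v → lookup x (f v)

_≟ˢ_ : ∀ {a} → Subset a → Subset a → Bool
σ ≟ˢ τ = ⌊ ≡-dec Bool._≟_ σ τ ⌋

record Covering (Y X : SimplicialComplex) : Set where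
  field
    u           : Fin (n Y) → Fin (n X)
    simplicial  : ∀ σ → T (isFace Y σ) → T (isFace X (image u σ))
    surjective  : ∀ x → ∃ λ y → u y ≡ x
    local-inj   : ∀ y σ τ → T (isFace Y σ) → T (isFace Y τ) → y ∈ σ → y ∈ τ →
                  image u σ ≡ image u τ → σ ≡ τ
    local-surj  : ∀ y ρ → T (isFace X ρ) → u y ∈ ρ →
                  Σ (Subset (n Y)) λ σ → T (isFace Y σ) × y ∈ σ × image u σ ≡ ρ

open Covering public

HasDegree : ∀ {Y X} → Covering Y X → ℕ → Set
HasDegree {Y} {X} cov m =
  ∀ x → T (isFace X x) →
  Σ (Fin m → Subset (n Y)) λ pre →
    Injective _≡_ _≡_ pre ×
    (∀ i → T (isFace Y (pre i)) × image (u cov) (pre i) ≡ x) ×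
    (∀ σ → T (isFace Y σ) → image (u cov) σ ≡ x → Σ (Fin m) λ i → pre i ≡ σ)

module LinAlg {c ℓ : Level} (F : Field c ℓ) where
  open Field F

  ∑ : ∀ {k} → (Fin k → Carrier) → Carrier
  ∑ {zero}  g = 0#
  ∑ {suc k} g = g Fin.zero + ∑ (λ i → g (Fin.suc i))


  ι : ℕ → Carrier
  ι zero    = 0#
  ι (suc k) = 1# + ι k

  lin : ∀ {a} {I : Set a} {d} → (Fin d → Carrier) → (Fin d → I → Carrier) → I → Carrier
  lin coef b i = ∑ λ j → coef j * b j i

  -- d = dim (Z / B): there are d vectors in Z whose classes form a basis of Z / B
  HasQuotDim : ∀ {a p q} {I : Set a} → ((I → Carrier) → Set p) → ((I → Carrier) → Set q) →
               ℕ → Set (a ⊔ c ⊔ ℓ ⊔ p ⊔ q)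
  HasQuotDim {I = I} Z B d =
    Σ (Fin d → I → Carrier) λ b →
      (∀ j → Z (b j)) ×
      (∀ coef → B (lin coef b) → ∀ j → coef j ≈ 0#) ×
      (∀ v → Z v → Σ (Fin d → Carrier) λ coef → B (λ i → v i + - lin coef b i))

-- Sheaves of F-vector spaces on a complex K whose stalks are coordinate
-- spaces and whose restriction maps are coordinate pullbacks, together
-- with a subsheaf cut out facewise.
--   coordinates: a type J; the stalk at a face x is  F^{ j | over x j };
--   restriction for x ⊊ x' sends (f_j)_j to (f_{pull x j'})_{j' over x'};
--   sub x : the subspace of the stalk at x defining a subsheaf.
-- Cochains in  C^i  (i = k - 1, k = number of vertices) are functions
-- c : Subset n → J → F supported on pairs (x , j) with x a face with k
-- vertices and j over x (a face of K is ordered by the order of Fin n,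
-- which identifies alternating cochains with these functions).

module Cohomology {c ℓ : Level} (F : Field c ℓ) where
  open Field F
  open LinAlg F public

  record CoordSheaf (K : SimplicialComplex) : Set (lsuc (c ⊔ ℓ)) where
    field
      J    : Set
      over : Subset (n K) → J → Bool
      pull : Subset (n K) → J → J
      sub  : Subset (n K) → (J → Carrier) → Set ℓ

  module _ {K : SimplicialComplex} (S : CoordSheaf K) where
    open CoordSheaf S

    Cochain : Set c
    Cochain = Subset (n K) → J → Carrier

    supp : ℕ → Subset (n K) → J → Bool
    supp k x j = isFace K x ∧ (⌊ ∣ x ∣ Data.Nat.≟ k ⌋ ∧ over x j)

    IsCochain : ℕ → Cochain → Set ℓ
    IsCochain k γ = (∀ x j → ¬ T (supp k x j) → γ x j ≈ 0#) ×
                    (∀ x → T (isFace K x) → ∣ x ∣ ≡ k → sub x (γ x))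

    sgn : ℕ → Carrier → Carrier
    sgn zero a    = a
    sgn (suc t) a = - sgn t a

    pos : Subset (n K) → Fin (n K) → ℕ
    pos x v = ∣ x ∩ tabulate (λ w → ⌊ w <ᶠ? v ⌋) ∣

    δ : Cochain → Cochain
    δ γ x' j' = if isFace K x' ∧ over x' j'
                then ∑ (λ v → if ⌊ v ∈? x' ⌋
                               then sgn (pos x' v) (γ (x' Sub.- v) (pull (x' Sub.- v) j'))
                               else 0#)
                else 0#

    -- cocycles and coboundaries in C^i  (k = i + 1 vertices; C^{-1} = 0
    -- automatically since no face has 0 vertices)
    Cocycle : ℕ → Cochain → Set ℓ
    Cocycle i γ = IsCochain (suc i) γ × (∀ x j → δ γ x j ≈ 0#)

    Coboundary : ℕ → Cochain → Set (c ⊔ ℓ)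
    Coboundary i γ = Σ Cochain λ η → IsCochain i η × (∀ x j → δ η x j ≈ γ x j)

    HasH : ℕ → ℕ → Set (c ⊔ ℓ)
    HasH i d = HasQuotDim {I = Subset (n K) × J}
                 (λ v → Cocycle i (curry v)) (λ v → Coboundary i (curry v)) d

  constSheaf : (K : SimplicialComplex) → CoordSheaf K
  constSheaf K = record { J = ⊤ ; over = λ _ _ → true ; pull = λ _ _ → tt
                        ; sub = λ _ _ → Lift.Lift ℓ ⊤ }
    where import Level as Lift

  ∑ˢ : ∀ {a} → (Subset a → Carrier) → Carrier
  ∑ˢ {zero}  g = g []
  ∑ˢ {suc a} g = ∑ˢ (λ s → g (inside ∷ s)) + ∑ˢ (λ s → g (outside ∷ s))

  -- G = ker φ ⊆ u_* F_Y, where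
  --   u_*F_Y(x) = ∏_{y ∈ u⁻¹(x)} F   (coordinates: faces y of Y with u(y) = x),
  --   restriction: the y'-coordinate is the coordinate of y'(x) = y' ∩ u⁻¹(x),
  --   φ_x((α_y)_y) = Σ_y α_y.
  kerSheaf : ∀ {Y X} → Covering Y X → CoordSheaf X
  kerSheaf {Y} {X} cov = record
    { J    = Subset (n Y)
    ; over = λ x y → isFace Y y ∧ (image (u cov) y ≟ˢ x)
    ; pull = λ x y' → y' ∩ preimage (u cov) x
    ; sub  = λ x α → ∑ˢ (λ y → if isFace Y y ∧ (image (u cov) y ≟ˢ x) then α y else 0#) ≈ 0#
    }

-- Averaging over fibres, (α_y) ↦ m⁻¹ Σ_y α_y, is a left inverse of the diagonal F_X → u_*F_Y
-- because m is invertible in F, so u_*F_Y ≅ G ⊕ F_X and h¹(u_*F_Y) = h¹(G) + h¹(X).  Since u is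
-- an isomorphism on every face, cochains of u_*F_Y are cochains of F_Y, up to the sign comparing
-- the vertex order of a face of Y with that of its image; hence h¹(u_*F_Y) = h¹(Y).  For h⁰, a
-- 0-cocycle of G read on Y is a 0-cocycle of F_Y, so it is constant on the connected Y, and its
-- fibre sums, m times that constant, vanish.

module Submission where

import Level
open Level using (Level; _⊔_) renaming (suc to lsuc; zero to lzero)
open import Algebra.Bundles using (CommutativeMonoid)
import Algebra.Properties.CommutativeMonoid.Sum as MonoidSum
import Algebra.Properties.CommutativeSemigroup as CommutativeSemigroupProperties
import Algebra.Properties.Ring as RingProperties
open import Data.Nat as Nat using (ℕ; zero; suc; _≤_; _<_; s≤s; _≤?_) renaming (_+_ to _+ℕ_; _*_ to _*ℕ_)
import Data.Nat.Properties as ℕₚ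
open import Data.Nat.Solver using (module +-*-Solver)
open import Data.Bool using (Bool; true; false; T; _∧_; _∨_; not; if_then_else_)
import Data.Bool as Bool
open import Data.Bool.Properties using (∧-zeroʳ; ∧-identityʳ; ∧-conicalˡ; ∧-conicalʳ; ∧-assoc; ∧-idem; ∨-zeroʳ; T-∧)
open import Data.Fin using (Fin; punchIn; _↑ˡ_; _↑ʳ_; splitAt)
import Data.Fin as Fin
open import Data.Fin.Properties using (splitAt⁻¹-↑ˡ; splitAt⁻¹-↑ʳ; <-cmp; <-irrefl)
open import Data.Fin.Subset using (Subset; inside; outside; _∈_; ⁅_⁆; _∪_; _∩_; _─_; ∣_∣) renaming (⊥ to ∅)
import Data.Fin.Subset as Sub
open import Data.Fin.Subset.Properties using (_∈?_; x∈⁅x⁆; x∈⁅y⁆⇒x≡y; ∪-idem; ∪-comm; ∣⁅x⁆∣≡1)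
open import Data.Vec using ([]; _∷_; lookup; tabulate)
open import Data.Vec.Properties using (≡-dec; []=⇒lookup; lookup⇒[]=; lookup-zipWith; lookup∘tabulate; tabulate∘lookup; tabulate-cong)
open import Data.Vec.Functional using (insertAt; _++_)
open import Data.Vec.Functional.Properties using (insertAt-lookup; insertAt-punchIn; lookup-++ˡ; lookup-++ʳ)
open import Data.Product using (Σ; ∃; _×_; _,_; proj₁; proj₂; curry; uncurry)
open import Data.Sum using (_⊎_; inj₁; inj₂)
open import Data.Unit using (⊤; tt)
open import Data.Empty using (⊥; ⊥-elim)
open import Function using (_∘_)
open import Function.Bundles using (Equivalence)
open import Relation.Nullary using (¬_; Dec; yes; no)
open import Relation.Nullary.Decidable using (⌊_⌋; toWitness; fromWitness)
open import Relation.Binary.Definitions using (DecidableEquality; tri<; tri≈; tri>)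
open import Relation.Binary.PropositionalEquality as ≡
  using (_≡_; _≢_; refl; sym; trans; cong; cong₂; cong-app; subst; subst₂; module ≡-Reasoning)
import Relation.Binary.Reasoning.Setoid as SetoidReasoning
open import Defs

false≢true : false ≡ true → ⊥
false≢true ()

T⇒≡true : ∀ {b} → T b → b ≡ true
T⇒≡true {true} _ = refl

≡true⇒T : ∀ {b} → b ≡ true → T b
≡true⇒T refl = _

T-∧⁻ : ∀ {a b} → T (a ∧ b) → T a × T b
T-∧⁻ = Equivalence.to T-∧

T-∧⁺ : ∀ {a b} → T a → T b → T (a ∧ b)
T-∧⁺ ta tb = Equivalence.from T-∧ (ta , tb)

¬T⇒≡false : ∀ {b} → ¬ T b → b ≡ false
¬T⇒≡false {true} ¬t = ⊥-elim (¬t _)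
¬T⇒≡false {false} _ = refl

≡true-ext : ∀ {b b'} → (b ≡ true → b' ≡ true) → (b' ≡ true → b ≡ true) → b ≡ b'
≡true-ext {true}  {true}  _ _ = refl
≡true-ext {true}  {false} f _ = sym (f refl)
≡true-ext {false} {true}  _ g = g refl
≡true-ext {false} {false} _ _ = refl

⌊⌋-true : ∀ {p} {A : Set p} (a? : Dec A) → A → ⌊ a? ⌋ ≡ true
⌊⌋-true a? a = T⇒≡true (fromWitness a)

⌊⌋-sound : ∀ {p} {A : Set p} {a? : Dec A} → ⌊ a? ⌋ ≡ true → A
⌊⌋-sound e = toWitness (≡true⇒T e)

_≡ᵇ_ : ∀ {k} → Fin k → Fin k → Bool
i ≡ᵇ j = ⌊ i Fin.≟ j ⌋

_!_ : ∀ {a} → Subset a → Fin a → Bool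
s ! v = lookup s v

∈⇒! : ∀ {a} {s : Subset a} {v} → v ∈ s → s ! v ≡ true
∈⇒! = []=⇒lookup

!⇒∈ : ∀ {a} {s : Subset a} {v} → s ! v ≡ true → v ∈ s
!⇒∈ {s = s} {v} = lookup⇒[]= v s

∈?≡! : ∀ {a} (v : Fin a) (s : Subset a) → ⌊ v ∈? s ⌋ ≡ s ! v
∈?≡! v s = ≡true-ext (λ e → ∈⇒! (⌊⌋-sound e)) (λ e → ⌊⌋-true (v ∈? s) (!⇒∈ e))

subset-ext : ∀ {a} {s t : Subset a} → (∀ v → s ! v ≡ t ! v) → s ≡ t
subset-ext {s = s} {t} h = trans (sym (tabulate∘lookup s)) (trans (tabulate-cong h) (tabulate∘lookup t))

!-∩ : ∀ {a} (s t : Subset a) v → (s ∩ t) ! v ≡ (s ! v ∧ t ! v)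
!-∩ s t v = lookup-zipWith _∧_ v s t

!-∪ : ∀ {a} (s t : Subset a) v → (s ∪ t) ! v ≡ (s ! v ∨ t ! v)
!-∪ s t v = lookup-zipWith _∨_ v s t

!-tabulate : ∀ {a} (f : Fin a → Bool) v → tabulate f ! v ≡ f v
!-tabulate = lookup∘tabulate

!-⁅⁆ : ∀ {a} (w v : Fin a) → ⁅ w ⁆ ! v ≡ (v ≡ᵇ w)
!-⁅⁆ w v = ≡true-ext (λ e → subst (λ z → (v ≡ᵇ z) ≡ true) (x∈⁅y⁆⇒x≡y w (!⇒∈ e)) (⌊⌋-true (v Fin.≟ v) refl))
                     (λ e → subst (λ z → ⁅ w ⁆ ! z ≡ true) (sym (⌊⌋-sound e)) (∈⇒! (x∈⁅x⁆ w)))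

!-─ : ∀ {a} (s t : Subset a) v → (s ─ t) ! v ≡ (s ! v ∧ not (t ! v))
!-─ (x ∷ s) (true ∷ t)  Fin.zero    = sym (∧-zeroʳ x)
!-─ (x ∷ s) (false ∷ t) Fin.zero    = sym (∧-identityʳ x)
!-─ (x ∷ s) (y ∷ t)     (Fin.suc v) = !-─ s t v

!-- : ∀ {a} (s : Subset a) w v → (s Sub.- w) ! v ≡ (s ! v ∧ not (v ≡ᵇ w))
!-- s w v = trans (!-─ s ⁅ w ⁆ v) (cong (λ b → s ! v ∧ not b) (!-⁅⁆ w v))

!-preimage : ∀ {a b} (f : Fin a → Fin b) (x : Subset b) v → preimage f x ! v ≡ x ! f v
!-preimage f x = !-tabulate _

!-image⁻ : ∀ {a b} (f : Fin a → Fin b) (σ : Subset a) w → image f σ ! w ≡ true →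
           Σ (Fin a) λ v → σ ! v ≡ true × f v ≡ w
!-image⁻ f σ w e with ⌊⌋-sound (trans (sym (!-tabulate _ w)) e)
... | v , v∈σ , fv≡w = v , ∈⇒! v∈σ , fv≡w

!-image⁺ : ∀ {a b} (f : Fin a → Fin b) (σ : Subset a) v → σ ! v ≡ true → image f σ ! f v ≡ true
!-image⁺ f σ v e = trans (!-tabulate _ (f v)) (⌊⌋-true _ (v , !⇒∈ e , refl))

⁅c⁆∪⁅d⁆-c≡⁅d⁆ : ∀ {a} (c d : Fin a) → c ≢ d → (⁅ c ⁆ ∪ ⁅ d ⁆) Sub.- c ≡ ⁅ d ⁆
⁅c⁆∪⁅d⁆-c≡⁅d⁆ c d c≢d = subset-ext λ w → trans (!-- (⁅ c ⁆ ∪ ⁅ d ⁆) c w)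
  (trans (cong (_∧ not (w ≡ᵇ c)) (trans (!-∪ ⁅ c ⁆ ⁅ d ⁆ w) (cong₂ _∨_ (!-⁅⁆ c w) (!-⁅⁆ d w))))
  (trans (only-d w) (sym (!-⁅⁆ d w))))
  where
  only-d : ∀ w → ((w ≡ᵇ c ∨ w ≡ᵇ d) ∧ not (w ≡ᵇ c)) ≡ (w ≡ᵇ d)
  only-d w with w ≡ᵇ c in w≡c | w ≡ᵇ d in w≡d
  ... | true  | true  = ⊥-elim (c≢d (trans (sym (⌊⌋-sound w≡c)) (⌊⌋-sound w≡d)))
  ... | true  | false = refl
  ... | false | _     = ∧-identityʳ _

-- Finite sums

module FiniteSums {c ℓ} (M : CommutativeMonoid c ℓ) where
  open CommutativeMonoid M hiding (refl; sym; trans) renaming (Carrier to C; _∙_ to _+_; ε to 0#; ∙-cong to +-cong)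
  private module ≈ = CommutativeMonoid M using (refl; sym; trans; reflexive)
  open SetoidReasoning setoid
  open CommutativeSemigroupProperties commutativeSemigroup using (interchange)
  private module FinSum = MonoidSum M

  record Summation (A : Set) : Set (c ⊔ ℓ) where
    field
      sum      : (A → C) → C
      sum-cong : ∀ {f g} → (∀ a → f a ≈ g a) → sum f ≈ sum g
      sum-+    : ∀ f g → sum (λ a → f a + g a) ≈ sum f + sum g
      sum-hom  : (h : C → C) → (∀ {x y} → x ≈ y → h x ≈ h y) → h 0# ≈ 0# →
                 (∀ x y → h (x + y) ≈ h x + h y) → ∀ f → sum (λ a → h (f a)) ≈ h (sum f)

    sum-0 : sum (λ _ → 0#) ≈ 0#
    sum-0 = sum-hom (λ _ → 0#) (λ _ → ≈.refl) ≈.refl (λ _ _ → ≈.sym (identityˡ 0#)) (λ _ → 0#)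

  record FiniteSum (A : Set) : Set (lsuc lzero ⊔ c ⊔ ℓ) where
    field
      summation : Summation A
    open Summation summation public
    field
      _≟_      : DecidableEquality A
      sum-comm : ∀ {B} (S : Summation B) (f : A → B → C) →
                 sum (λ a → Summation.sum S (f a)) ≈ Summation.sum S (λ b → sum (λ a → f a b))
      sum-δ    : ∀ a (g : A → C) → sum (λ x → if ⌊ x ≟ a ⌋ then g x else 0#) ≈ g a

  summation-Fin : ∀ k → Summation (Fin k)
  summation-Fin k = record
    { sum = FinSum.sum
    ; sum-cong = FinSum.sum-cong-≋
    ; sum-+ = FinSum.∑-distrib-+
    ; sum-hom = hom
    }
    where
    hom : ∀ {k} h → (∀ {x y} → x ≈ y → h x ≈ h y) → h 0# ≈ 0# → (∀ x y → h (x + y) ≈ h x + h y) →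
          ∀ (f : Fin k → C) → FinSum.sum (λ i → h (f i)) ≈ h (FinSum.sum f)
    hom {zero}  h h-cong h-0 h-+ f = ≈.sym h-0
    hom {suc k} h h-cong h-0 h-+ f = ≈.trans (+-cong ≈.refl (hom h h-cong h-0 h-+ (f ∘ Fin.suc))) (≈.sym (h-+ _ _))

  subsetSum : ∀ {a} → (Subset a → C) → C
  subsetSum {zero}  g = g []
  subsetSum {suc a} g = subsetSum (λ s → g (inside ∷ s)) + subsetSum (λ s → g (outside ∷ s))

  summation-Subset : ∀ a → Summation (Subset a)
  summation-Subset a = record { sum = subsetSum ; sum-cong = cong' ; sum-+ = plus ; sum-hom = hom }
    where
    cong' : ∀ {a} {f g : Subset a → C} → (∀ s → f s ≈ g s) → subsetSum f ≈ subsetSum g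
    cong' {zero}  f≈g = f≈g []
    cong' {suc a} f≈g = +-cong (cong' {a} (λ s → f≈g _)) (cong' {a} (λ s → f≈g _))
    plus : ∀ {a} (f g : Subset a → C) → subsetSum (λ s → f s + g s) ≈ subsetSum f + subsetSum g
    plus {zero}  f g = ≈.refl
    plus {suc a} f g = ≈.trans (+-cong (plus {a} _ _) (plus {a} _ _)) (interchange _ _ _ _)
    hom : ∀ {a} h → (∀ {x y} → x ≈ y → h x ≈ h y) → h 0# ≈ 0# → (∀ x y → h (x + y) ≈ h x + h y) →
          ∀ (f : Subset a → C) → subsetSum (λ s → h (f s)) ≈ h (subsetSum f)
    hom {zero}  h h-cong h-0 h-+ f = ≈.refl
    hom {suc a} h h-cong h-0 h-+ f = ≈.trans (+-cong (hom {a} h h-cong h-0 h-+ _) (hom {a} h h-cong h-0 h-+ _)) (≈.sym (h-+ _ _))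

  finiteSum-Fin : ∀ k → FiniteSum (Fin k)
  finiteSum-Fin k = record
    { summation = summation-Fin k
    ; _≟_ = Fin._≟_
    ; sum-comm = fubini
    ; sum-δ = δ
    }
    where
    fubini : ∀ {k B} (S : Summation B) (f : Fin k → B → C) →
           FinSum.sum (λ i → Summation.sum S (f i)) ≈ Summation.sum S (λ b → FinSum.sum (λ i → f i b))
    fubini {zero}  S f = ≈.sym (Summation.sum-0 S)
    fubini {suc k} S f = ≈.trans (+-cong ≈.refl (fubini S (f ∘ Fin.suc))) (≈.sym (Summation.sum-+ S _ _))
    δ : ∀ {k} (j : Fin k) (g : Fin k → C) → FinSum.sum (λ i → if i ≡ᵇ j then g i else 0#) ≈ g j
    δ {suc k} Fin.zero    g = ≈.trans (+-cong ≈.refl (Summation.sum-0 (summation-Fin k))) (identityʳ _)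
    δ {suc k} (Fin.suc j) g = ≈.trans (+-cong ≈.refl (≈.trans (FinSum.sum-cong-≋ {k} (λ i → suc-case i)) (δ j (g ∘ Fin.suc))))
                                    (identityˡ _)
      where
      suc-case : ∀ i → (if Fin.suc i ≡ᵇ Fin.suc j then g (Fin.suc i) else 0#) ≈ (if i ≡ᵇ j then g (Fin.suc i) else 0#)
      suc-case i with i Fin.≟ j
      ... | yes _ = ≈.refl
      ... | no _  = ≈.refl

  subsetSum-fubini : ∀ {a B} (S : Summation B) (f : Subset a → B → C) →
                     subsetSum (λ s → Summation.sum S (f s)) ≈ Summation.sum S (λ b → subsetSum (λ s → f s b))
  subsetSum-fubini {zero}  S f = ≈.refl
  subsetSum-fubini {suc a} S f =
    ≈.trans (+-cong (subsetSum-fubini {a} S _) (subsetSum-fubini {a} S _)) (≈.sym (Summation.sum-+ S _ _))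

  subsetSum-δ : ∀ {a} (t : Subset a) (g : Subset a → C) → subsetSum (λ s → if s ≟ˢ t then g s else 0#) ≈ g t
  subsetSum-δ {zero}  [] g = ≈.refl
  subsetSum-δ {suc a} (x ∷ t) g = ≈.trans (+-cong (sum-cong S (λ s → head-match inside s)) (sum-cong S (λ s → head-match outside s))) (by-head x)
    where
    S = summation-Subset a
    open Summation using (sum-cong; sum-0)
    head-match : ∀ y s → (if (y ∷ s) ≟ˢ (x ∷ t) then g (y ∷ s) else 0#) ≈
                         (if ⌊ y Bool.≟ x ⌋ ∧ (s ≟ˢ t) then g (y ∷ s) else 0#)
    head-match y s with y Bool.≟ x | ≡-dec Bool._≟_ s t
    ... | yes _ | yes _ = ≈.refl
    ... | yes _ | no _  = ≈.refl
    ... | no _  | _     = ≈.refl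
    by-head : ∀ x → subsetSum (λ s → if ⌊ inside Bool.≟ x ⌋ ∧ (s ≟ˢ t) then g (inside ∷ s) else 0#)
                    + subsetSum (λ s → if ⌊ outside Bool.≟ x ⌋ ∧ (s ≟ˢ t) then g (outside ∷ s) else 0#) ≈ g (x ∷ t)
    by-head inside  = ≈.trans (+-cong (subsetSum-δ t (λ s → g (inside ∷ s))) (sum-0 S)) (identityʳ _)
    by-head outside = ≈.trans (+-cong (sum-0 S) (subsetSum-δ t (λ s → g (outside ∷ s)))) (identityˡ _)

  finiteSum-Subset : ∀ a → FiniteSum (Subset a)
  finiteSum-Subset a = record
    { summation = summation-Subset a
    ; _≟_ = ≡-dec Bool._≟_
    ; sum-comm = subsetSum-fubini
    ; sum-δ = subsetSum-δ
    }

  module _ {A B : Set} (SA : FiniteSum A) (SB : FiniteSum B) where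
    private
      module A = FiniteSum SA
      module B = FiniteSum SB

    sum-reindex : (P : A → Bool) (Q : B → Bool) (r : A → B) →
      (∀ a → P a ≡ true → Q (r a) ≡ true) →
      (∀ a a' → P a ≡ true → P a' ≡ true → r a ≡ r a' → a ≡ a') →
      (∀ b → Q b ≡ true → Σ A λ a → P a ≡ true × r a ≡ b) →
      (f : B → C) →
      A.sum (λ a → if P a then f (r a) else 0#) ≈ B.sum (λ b → if Q b then f b else 0#)
    sum-reindex P Q r pres inj surj f = begin
      A.sum (λ a → if P a then f (r a) else 0#)                          ≈⟨ A.sum-cong expand ⟩
      A.sum (λ a → B.sum (λ b → if P a ∧ ⌊ b B.≟ r a ⌋ then f b else 0#)) ≈⟨ A.sum-comm B.summation _ ⟩
      B.sum (λ b → A.sum (λ a → if P a ∧ ⌊ b B.≟ r a ⌋ then f b else 0#)) ≈⟨ B.sum-cong fibre ⟩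
      B.sum (λ b → if Q b then f b else 0#)                              ∎
      where
      expand : ∀ a → (if P a then f (r a) else 0#) ≈ B.sum (λ b → if P a ∧ ⌊ b B.≟ r a ⌋ then f b else 0#)
      expand a with P a
      ... | true  = ≈.sym (B.sum-δ (r a) f)
      ... | false = ≈.sym B.sum-0
      fibre : ∀ b → A.sum (λ a → if P a ∧ ⌊ b B.≟ r a ⌋ then f b else 0#) ≈ (if Q b then f b else 0#)
      fibre b with Q b in Qb
      ... | true with surj b Qb
      ...   | a₀ , Pa₀ , ra₀≡b = ≈.trans (A.sum-cong (λ a → ≈.reflexive (cong (λ t → if t then f b else 0#) (only-a₀ a))))
                                        (A.sum-δ a₀ (λ _ → f b))
        where
        only-a₀ : ∀ a → (P a ∧ ⌊ b B.≟ r a ⌋) ≡ ⌊ a A.≟ a₀ ⌋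
        only-a₀ a with P a in Pa | b B.≟ r a | a A.≟ a₀
        ... | true  | yes _    | yes _    = refl
        ... | true  | yes b≡ra | no a≢a₀ = ⊥-elim (a≢a₀ (inj a a₀ Pa Pa₀ (trans (sym b≡ra) (sym ra₀≡b))))
        ... | true  | no b≢ra  | yes refl = ⊥-elim (b≢ra (sym ra₀≡b))
        ... | true  | no _     | no _     = refl
        ... | false | _        | no _     = refl
        ... | false | _        | yes refl with trans (sym Pa) Pa₀
        ...   | ()
      fibre b | false = ≈.trans (A.sum-cong (λ a → ≈.reflexive (cong (λ t → if t then f b else 0#) (outside-image a)))) A.sum-0
        where
        outside-image : ∀ a → (P a ∧ ⌊ b B.≟ r a ⌋) ≡ false
        outside-image a with P a in Pa | b B.≟ r a
        ... | false | _        = refl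
        ... | true  | no _     = refl
        ... | true  | yes refl with trans (sym (pres a Pa)) Qb
        ...   | ()

  sum-transport : ∀ {A} (S : FiniteSum A) (s : (A → C) → C) → (∀ f → s f ≡ FiniteSum.sum S f) → FiniteSum A
  sum-transport S s s≡ = record
    { summation = record
      { sum = s
      ; sum-cong = λ {f} {g} f≈g → ≈.trans (≈.reflexive (s≡ f)) (≈.trans (S.sum-cong f≈g) (back g))
      ; sum-+ = λ f g → ≈.trans (≈.reflexive (s≡ _)) (≈.trans (S.sum-+ f g) (+-cong (back f) (back g)))
      ; sum-hom = λ h h-cong h-0 h-+ f → ≈.trans (≈.reflexive (s≡ _)) (≈.trans (S.sum-hom h h-cong h-0 h-+ f) (h-cong (back f)))
      }
    ; _≟_ = S._≟_
    ; sum-comm = λ T f → ≈.trans (≈.reflexive (s≡ _)) (≈.trans (S.sum-comm T f) (Summation.sum-cong T (λ b → back (λ a → f a b))))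
    ; sum-δ = λ a g → ≈.trans (≈.reflexive (s≡ _)) (S.sum-δ a g)
    }
    where
    module S = FiniteSum S
    back : ∀ f → S.sum f ≈ s f
    back f = ≈.reflexive (sym (s≡ f))

-- Dimensions of subquotients

module LinearAlgebra {c ℓ} (F : Field c ℓ) where
  open Field F hiding (refl; sym; trans; reflexive) renaming (Carrier to C)
  private module ≈ = Field F using (refl; sym; trans; reflexive)
  open LinAlg F
  open RingProperties ring using (-0#≈0#; -‿distribˡ-*; -‿distribʳ-*; x∙y⁻¹≈ε⇒x≈y; x[y-z]≈xy-xz; -1*x≈-x; -‿+-comm)
  open SetoidReasoning setoid
  open FiniteSums +-commutativeMonoid
  open CommutativeSemigroupProperties +-commutativeSemigroup using (interchange)

  ∑≡sum : ∀ {k} (g : Fin k → C) → ∑ g ≡ FiniteSum.sum (finiteSum-Fin k) g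
  ∑≡sum {zero}  g = refl
  ∑≡sum {suc k} g = cong (g Fin.zero +_) (∑≡sum (g ∘ Fin.suc))

  finiteSum∑ : ∀ k → FiniteSum (Fin k)
  finiteSum∑ k = sum-transport (finiteSum-Fin k) ∑ ∑≡sum

  module ∑ {k} = FiniteSum (finiteSum∑ k)

  ∑-scaleˡ : ∀ {k} a (f : Fin k → C) → ∑ (λ i → a * f i) ≈ a * ∑ f
  ∑-scaleˡ a = ∑.sum-hom (a *_) *-congˡ (zeroʳ a) (distribˡ a)

  ∑-scaleʳ : ∀ {k} a (f : Fin k → C) → ∑ (λ i → f i * a) ≈ ∑ f * a
  ∑-scaleʳ a = ∑.sum-hom (_* a) *-congʳ (zeroˡ a) (λ x y → distribʳ a x y)

  ∑-neg : ∀ {k} (f : Fin k → C) → ∑ (λ i → - f i) ≈ - ∑ f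
  ∑-neg = ∑.sum-hom -_ -‿cong -0#≈0# (λ x y → ≈.sym (-‿+-comm x y))

  ∑-- : ∀ {k} (f g : Fin k → C) → ∑ (λ i → f i - g i) ≈ ∑ f - ∑ g
  ∑-- f g = ≈.trans (∑.sum-+ f (λ i → - g i)) (+-congˡ (∑-neg g))

  ∑-remove : ∀ {d} (p : Fin (suc d)) (f : Fin (suc d) → C) → ∑ f ≈ f p + ∑ (f ∘ punchIn p)
  ∑-remove p f = ≈.trans (≈.reflexive (∑≡sum f))
                   (≈.trans (FinSum.sum-remove f) (+-congˡ (≈.reflexive (sym (∑≡sum (f ∘ punchIn p))))))
    where module FinSum = MonoidSum +-commutativeMonoid

  -- equality in F need not be decidable, so this case split is only available for proving ⊥
  ¬¬-all⊎counterexample : ∀ {p d} (P : Fin d → Set p) → ((∀ j → P j) → ⊥) → (∃ (λ j → ¬ P j) → ⊥) → ⊥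
  ¬¬-all⊎counterexample {d = zero}  P ¬all ¬ex = ¬all (λ ())
  ¬¬-all⊎counterexample {d = suc d} P ¬all ¬ex =
    ¬¬-all⊎counterexample (P ∘ Fin.suc)
      (λ all-suc → ¬ex (Fin.zero , λ P0 → ¬all (λ { Fin.zero → P0 ; (Fin.suc j) → all-suc j })))
      (λ { (j , ¬Pj) → ¬ex (Fin.suc j , ¬Pj) })

  LeftKernel : ∀ {d k} → (Fin d → Fin k → C) → (Fin d → C) → Set ℓ
  LeftKernel A x = ∀ l → ∑ (λ j → x j * A j l) ≈ 0#

  TrivialLeftKernel : ∀ {d k} → (Fin d → Fin k → C) → Set (c ⊔ ℓ)
  TrivialLeftKernel A = ∀ x → LeftKernel A x → ∀ j → x j ≈ 0#

  module PivotElimination {d k} (A : Fin (suc d) → Fin (suc k) → C)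
                          (p : Fin (suc d)) (a⁻¹ : C) (pivot : A p Fin.zero * a⁻¹ ≈ 1#) where

    eliminated : Fin d → Fin k → C
    eliminated i l = A (punchIn p i) (Fin.suc l) - (A (punchIn p i) Fin.zero * a⁻¹) * A p (Fin.suc l)

    weight : (Fin d → C) → C
    weight x = ∑ (λ i → x i * (A (punchIn p i) Fin.zero * a⁻¹))

    extend : (Fin d → C) → Fin (suc d) → C
    extend x = insertAt x p (- weight x)

    rows≈weight*pivotRow : ∀ x → LeftKernel eliminated x →
                           ∀ l → ∑ (λ i → x i * A (punchIn p i) l) ≈ weight x * A p l
    rows≈weight*pivotRow x ker Fin.zero = ≈.sym (begin
      weight x * A p Fin.zero                                    ≈⟨ ∑-scaleʳ {d} _ _ ⟨
      ∑ (λ i → (x i * (A (punchIn p i) Fin.zero * a⁻¹)) * A p Fin.zero) ≈⟨ ∑.sum-cong {d} cancel ⟩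
      ∑ (λ i → x i * A (punchIn p i) Fin.zero)                   ∎)
      where
      cancel : ∀ i → (x i * (A (punchIn p i) Fin.zero * a⁻¹)) * A p Fin.zero ≈ x i * A (punchIn p i) Fin.zero
      cancel i = begin
        (x i * (A (punchIn p i) Fin.zero * a⁻¹)) * A p Fin.zero ≈⟨ *-assoc _ _ _ ⟩
        x i * ((A (punchIn p i) Fin.zero * a⁻¹) * A p Fin.zero) ≈⟨ *-congˡ (*-assoc _ _ _) ⟩
        x i * (A (punchIn p i) Fin.zero * (a⁻¹ * A p Fin.zero)) ≈⟨ *-congˡ (*-congˡ (≈.trans (*-comm _ _) pivot)) ⟩
        x i * (A (punchIn p i) Fin.zero * 1#)                  ≈⟨ *-congˡ (*-identityʳ _) ⟩
        x i * A (punchIn p i) Fin.zero                         ∎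
    rows≈weight*pivotRow x ker (Fin.suc l) = begin
      ∑ (λ i → x i * A (punchIn p i) (Fin.suc l))
        ≈⟨ x∙y⁻¹≈ε⇒x≈y _ _ (≈.trans (≈.sym (∑-- {d} _ _)) (≈.trans (∑.sum-cong {d} (λ i → ≈.sym (x[y-z]≈xy-xz _ _ _))) (ker l))) ⟩
      ∑ (λ i → x i * ((A (punchIn p i) Fin.zero * a⁻¹) * A p (Fin.suc l)))
        ≈⟨ ∑.sum-cong {d} (λ i → ≈.sym (*-assoc _ _ _)) ⟩
      ∑ (λ i → (x i * (A (punchIn p i) Fin.zero * a⁻¹)) * A p (Fin.suc l))
        ≈⟨ ∑-scaleʳ {d} _ _ ⟩
      weight x * A p (Fin.suc l) ∎

    extend-kernel : ∀ x → LeftKernel eliminated x → LeftKernel A (extend x)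
    extend-kernel x ker l = begin
      ∑ (λ j → extend x j * A j l)
        ≈⟨ ∑-remove p (λ j → extend x j * A j l) ⟩
      extend x p * A p l + ∑ (λ i → extend x (punchIn p i) * A (punchIn p i) l)
        ≈⟨ +-cong (*-congʳ (≈.reflexive (insertAt-lookup x p _)))
                  (∑.sum-cong {d} (λ i → *-congʳ (≈.reflexive (insertAt-punchIn x p _ i)))) ⟩
      - weight x * A p l + ∑ (λ i → x i * A (punchIn p i) l)
        ≈⟨ +-cong (≈.sym (-‿distribˡ-* _ _)) (rows≈weight*pivotRow x ker l) ⟩
      - (weight x * A p l) + weight x * A p l
        ≈⟨ -‿inverseˡ _ ⟩
      0# ∎

  tall⇒¬trivialLeftKernel : ∀ {k d} → k < d → (A : Fin d → Fin k → C) → ¬ TrivialLeftKernel A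
  tall⇒¬trivialLeftKernel {zero} {suc d} _ A trivial = 0≉1 (≈.sym (trivial (λ _ → 1#) (λ ()) Fin.zero))
  tall⇒¬trivialLeftKernel {suc k} {suc d} (s≤s k<d) A trivial =
    ¬¬-all⊎counterexample (λ j → A j Fin.zero ≈ 0#) zero-column pivot-column
    where
    zero-column : (∀ j → A j Fin.zero ≈ 0#) → ⊥
    zero-column A0 = tall⇒¬trivialLeftKernel (ℕₚ.≤-trans k<d (ℕₚ.n≤1+n d)) (λ j l → A j (Fin.suc l))
      (λ x ker → trivial x λ
        { Fin.zero → ≈.trans (∑.sum-cong {suc d} (λ j → ≈.trans (*-congˡ (A0 j)) (zeroʳ (x j)))) (∑.sum-0 {suc d})
        ; (Fin.suc l) → ker l })
    pivot-column : ∃ (λ p → ¬ (A p Fin.zero ≈ 0#)) → ⊥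
    pivot-column (p , A-p≉0) = tall⇒¬trivialLeftKernel k<d eliminated
      (λ x ker i → ≈.trans (≈.sym (≈.reflexive (insertAt-punchIn x p _ i))) (trivial (extend x) (extend-kernel x ker) (punchIn p i)))
      where
      open PivotElimination A p (proj₁ (inverse _ A-p≉0)) (proj₂ (inverse _ A-p≉0))

  private variable
    a a₁ a₂ p z z₁ z₂ y y₁ y₂ : Level
    I : Set a
    I₁ : Set a₁
    I₂ : Set a₂

  lin-cong : ∀ {d} (x : Fin d → C) {b b' : Fin d → I → C} → (∀ j i → b j i ≈ b' j i) → ∀ i → lin x b i ≈ lin x b' i
  lin-cong {d = d} x b≈b' i = ∑.sum-cong {d} (λ j → *-congˡ (b≈b' j i))

  lin-congˡ : ∀ {d} {x x' : Fin d → C} {b : Fin d → I → C} → (∀ j → x j ≈ x' j) → ∀ i → lin x b i ≈ lin x' b i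
  lin-congˡ {d = d} x≈x' i = ∑.sum-cong {d} (λ j → *-congʳ (x≈x' j))

  [a-b]+[c-d]≈[a+c]-[b+d] : ∀ a b c d → (a - b) + (c - d) ≈ (a + c) - (b + d)
  [a-b]+[c-d]≈[a+c]-[b+d] a b c d =
    ≈.trans (interchange a (- b) c (- d))
            (+-congˡ (-‿+-comm b d))

  lin-0 : ∀ {d} (x : Fin d → C) {b : Fin d → I → C} → (∀ j i → b j i ≈ 0#) → ∀ i → lin x b i ≈ 0#
  lin-0 {d = d} x b≈0 i = ≈.trans (lin-cong x b≈0 i) (≈.trans (∑.sum-cong {d} (λ j → zeroʳ (x j))) (∑.sum-0 {d}))

  record Subspace {I : Set a} (P : (I → C) → Set p) : Set (a ⊔ c ⊔ ℓ ⊔ p) where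
    field
      closed-≈ : ∀ {v w} → (∀ i → v i ≈ w i) → P v → P w
      closed-0 : P (λ _ → 0#)
      closed-+ : ∀ {v w} → P v → P w → P (λ i → v i + w i)
      closed-* : ∀ a {v} → P v → P (λ i → a * v i)

    closed-lin : ∀ {d} (x : Fin d → C) (w : Fin d → I → C) → (∀ j → P (w j)) → P (lin x w)
    closed-lin {zero}  x w Pw = closed-0
    closed-lin {suc d} x w Pw =
      closed-+ (closed-* (x Fin.zero) (Pw Fin.zero)) (closed-lin (x ∘ Fin.suc) (w ∘ Fin.suc) (Pw ∘ Fin.suc))

  independent≤spanning : {B : (I → C) → Set p} → Subspace B →
    ∀ {d k} (b : Fin d → I → C) (e : Fin k → I → C) →
    (∀ x → B (lin x b) → ∀ j → x j ≈ 0#) →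
    (∀ j → Σ (Fin k → C) λ y → B (λ i → b j i - lin y e i)) → d ≤ k
  independent≤spanning {B = B} B-sub {d} {k} b e independent spans with d ≤? k
  ... | yes d≤k = d≤k
  ... | no d≰k = ⊥-elim (tall⇒¬trivialLeftKernel (ℕₚ.≰⇒> d≰k) A trivial)
    where
    open Subspace B-sub
    A : Fin d → Fin k → C
    A j = proj₁ (spans j)
    trivial : TrivialLeftKernel A
    trivial x ker = independent x (closed-≈ residue-vanishes
      (closed-lin x (λ j i → b j i - lin (A j) e i) (λ j → proj₂ (spans j))))
      where
      combination-vanishes : ∀ i → ∑ (λ j → x j * lin (A j) e i) ≈ 0#
      combination-vanishes i = begin
        ∑ (λ j → x j * ∑ (λ l → A j l * e l i))   ≈⟨ ∑.sum-cong {d} (λ j → ∑-scaleˡ {k} (x j) _) ⟨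
        ∑ (λ j → ∑ (λ l → x j * (A j l * e l i))) ≈⟨ ∑.sum-comm {d} (∑.summation {k}) _ ⟩
        ∑ (λ l → ∑ (λ j → x j * (A j l * e l i))) ≈⟨ ∑.sum-cong {k} (λ l → ∑.sum-cong {d} (λ j → *-assoc _ _ _)) ⟨
        ∑ (λ l → ∑ (λ j → (x j * A j l) * e l i)) ≈⟨ ∑.sum-cong {k} (λ l → ∑-scaleʳ {d} (e l i) _) ⟩
        ∑ (λ l → ∑ (λ j → x j * A j l) * e l i)   ≈⟨ ∑.sum-cong {k} (λ l → ≈.trans (*-congʳ (ker l)) (zeroˡ _)) ⟩
        ∑ {k} (λ l → 0#)                          ≈⟨ ∑.sum-0 {k} ⟩
        0#                                        ∎
      residue-vanishes : ∀ i → lin x (λ j i → b j i - lin (A j) e i) i ≈ lin x b i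
      residue-vanishes i = begin
        ∑ (λ j → x j * (b j i - lin (A j) e i))         ≈⟨ ∑.sum-cong {d} (λ j → x[y-z]≈xy-xz _ _ _) ⟩
        ∑ (λ j → x j * b j i - x j * lin (A j) e i)     ≈⟨ ∑-- {d} _ _ ⟩
        lin x b i - ∑ (λ j → x j * lin (A j) e i)       ≈⟨ +-congˡ (-‿cong (combination-vanishes i)) ⟩
        lin x b i - 0#                                  ≈⟨ +-congˡ -0#≈0# ⟩
        lin x b i + 0#                                  ≈⟨ +-identityʳ _ ⟩
        lin x b i                                       ∎

  quotDim-unique : {Z : (I → C) → Set z} {B : (I → C) → Set y} → Subspace B →
                   ∀ {d d'} → HasQuotDim Z B d → HasQuotDim Z B d' → d ≡ d'
  quotDim-unique B-sub (b , Zb , indep , span) (b' , Zb' , indep' , span') =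
    ℕₚ.≤-antisym (independent≤spanning B-sub b b' indep (λ j → span' (b j) (Zb j)))
              (independent≤spanning B-sub b' b indep' (λ j → span (b' j) (Zb' j)))

  record LinearMap (I₁ : Set a₁) (I₂ : Set a₂) : Set (a₁ ⊔ a₂ ⊔ c ⊔ ℓ) where
    field
      apply      : (I₁ → C) → (I₂ → C)
      apply-cong : ∀ {v w} → (∀ i → v i ≈ w i) → ∀ i → apply v i ≈ apply w i
      apply-+    : ∀ v w i → apply (λ j → v j + w j) i ≈ apply v i + apply w i
      apply-*    : ∀ a v i → apply (λ j → a * v j) i ≈ a * apply v i

    apply-0 : ∀ i → apply (λ _ → 0#) i ≈ 0#
    apply-0 i = ≈.trans (apply-cong (λ _ → ≈.sym (zeroˡ 0#)) i) (≈.trans (apply-* 0# (λ _ → 0#) i) (zeroˡ _))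

    apply-lin : ∀ {d} (x : Fin d → C) (b : Fin d → I₁ → C) i → apply (lin x b) i ≈ lin x (λ j → apply (b j)) i
    apply-lin {zero}  x b i = apply-0 i
    apply-lin {suc d} x b i =
      ≈.trans (apply-+ _ _ i) (+-cong (apply-* _ _ i) (apply-lin (x ∘ Fin.suc) (b ∘ Fin.suc) i))

    apply-- : ∀ v w i → apply (λ j → v j - w j) i ≈ apply v i - apply w i
    apply-- v w i = begin
      apply (λ j → v j - w j) i          ≈⟨ apply-+ v _ i ⟩
      apply v i + apply (λ j → - w j) i  ≈⟨ +-congˡ (apply-cong (λ j → ≈.sym (-1*x≈-x (w j))) i) ⟩
      apply v i + apply (λ j → - 1# * w j) i ≈⟨ +-congˡ (≈.trans (apply-* (- 1#) w i) (-1*x≈-x _)) ⟩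
      apply v i - apply w i              ∎

  open LinearMap public

  record Subquotient (I : Set a) (z y : Level) : Set (a ⊔ c ⊔ ℓ ⊔ lsuc (z ⊔ y)) where
    field
      Z          : (I → C) → Set z
      B          : (I → C) → Set y
      B-subspace : Subspace B

    HasDim : ℕ → Set (a ⊔ c ⊔ ℓ ⊔ z ⊔ y)
    HasDim = HasQuotDim Z B

  open Subquotient public

  record SubquotientMap {a₁ a₂ z₁ y₁ z₂ y₂} {I₁ : Set a₁} {I₂ : Set a₂}
                        (S : Subquotient I₁ z₁ y₁) (T : Subquotient I₂ z₂ y₂)
         : Set (a₁ ⊔ a₂ ⊔ c ⊔ ℓ ⊔ z₁ ⊔ y₁ ⊔ z₂ ⊔ y₂) where
    field
      linearMap   : LinearMap I₁ I₂
      preserves-Z : ∀ v → Z S v → Z T (apply linearMap v)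
      preserves-B : ∀ v → B S v → B T (apply linearMap v)

  open SubquotientMap public

  ⟦_⟧ : ∀ {a₁ a₂ z₁ y₁ z₂ y₂} {I₁ : Set a₁} {I₂ : Set a₂} {S : Subquotient I₁ z₁ y₁} {T : Subquotient I₂ z₂ y₂} →
        SubquotientMap S T → (I₁ → C) → (I₂ → C)
  ⟦ f ⟧ = apply (linearMap f)

  module _ {a₁ a₂ z₁ y₁ z₂ y₂} {I₁ : Set a₁} {I₂ : Set a₂}
           {S : Subquotient I₁ z₁ y₁} {T : Subquotient I₂ z₂ y₂} where

    hasDim-iso : (f : SubquotientMap S T) (g : SubquotientMap T S) →
                 (∀ v → Z S v → ∀ i → ⟦ g ⟧ (⟦ f ⟧ v) i ≈ v i) →
                 (∀ v → Z T v → ∀ i → ⟦ f ⟧ (⟦ g ⟧ v) i ≈ v i) →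
                 ∀ {d} → HasDim S d → HasDim T d
    hasDim-iso f g gf≈id fg≈id (b , Zb , independent , spans) =
      (λ j → ⟦ f ⟧ (b j)) , (λ j → preserves-Z f _ (Zb j)) , independent' , spans'
      where
      independent' : ∀ x → B T (lin x (λ j → ⟦ f ⟧ (b j))) → ∀ j → x j ≈ 0#
      independent' x B-fx = independent x (Subspace.closed-≈ (B-subspace S)
        (λ i → ≈.trans (apply-lin (linearMap g) x _ i) (lin-cong x (λ j i → gf≈id _ (Zb j) i) i))
        (preserves-B g _ B-fx))
      spans' : ∀ v → Z T v → Σ _ λ x → B T (λ i → v i - lin x (λ j → ⟦ f ⟧ (b j)) i)
      spans' v Zv with spans (⟦ g ⟧ v) (preserves-Z g v Zv)
      ... | x , B-residue = x , Subspace.closed-≈ (B-subspace T)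
        (λ i → ≈.trans (apply-- (linearMap f) _ _ i) (+-cong (fg≈id v Zv i) (-‿cong (apply-lin (linearMap f) x b i))))
        (preserves-B f _ B-residue)

  ↑-cases : ∀ {d₁ d₂} (j : Fin (d₁ +ℕ d₂)) → (∃ λ j₁ → j₁ ↑ˡ d₂ ≡ j) ⊎ (∃ λ j₂ → d₁ ↑ʳ j₂ ≡ j)
  ↑-cases {d₁} j with splitAt d₁ j in eq
  ... | inj₁ j₁ = inj₁ (j₁ , splitAt⁻¹-↑ˡ eq)
  ... | inj₂ j₂ = inj₂ (j₂ , splitAt⁻¹-↑ʳ eq)

  ∑-split : ∀ {d₁ d₂} (h : Fin (d₁ +ℕ d₂) → C) → ∑ h ≈ ∑ (λ j → h (j ↑ˡ d₂)) + ∑ (λ j → h (d₁ ↑ʳ j))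
  ∑-split {zero}   h = ≈.sym (+-identityˡ _)
  ∑-split {suc d₁} h = ≈.trans (+-congˡ (∑-split {d₁} (h ∘ Fin.suc))) (≈.sym (+-assoc _ _ _))

  record DirectSum {a₁ a₂ a z₁ y₁ z₂ y₂ z y} {I₁ : Set a₁} {I₂ : Set a₂} {I : Set a}
                   (S₁ : Subquotient I₁ z₁ y₁) (S₂ : Subquotient I₂ z₂ y₂) (T : Subquotient I z y)
                   : Set (a₁ ⊔ a₂ ⊔ a ⊔ c ⊔ ℓ ⊔ z₁ ⊔ y₁ ⊔ z₂ ⊔ y₂ ⊔ z ⊔ y) where
    field
      ι₁ : SubquotientMap S₁ T
      ι₂ : SubquotientMap S₂ T
      π₁ : SubquotientMap T S₁
      π₂ : SubquotientMap T S₂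
      π₁ι₁ : ∀ v → Z S₁ v → ∀ i → ⟦ π₁ ⟧ (⟦ ι₁ ⟧ v) i ≈ v i
      π₂ι₁ : ∀ v → Z S₁ v → ∀ i → ⟦ π₂ ⟧ (⟦ ι₁ ⟧ v) i ≈ 0#
      π₁ι₂ : ∀ v → Z S₂ v → ∀ i → ⟦ π₁ ⟧ (⟦ ι₂ ⟧ v) i ≈ 0#
      π₂ι₂ : ∀ v → Z S₂ v → ∀ i → ⟦ π₂ ⟧ (⟦ ι₂ ⟧ v) i ≈ v i
      ι₁π₁+ι₂π₂ : ∀ v → Z T v → ∀ i → ⟦ ι₁ ⟧ (⟦ π₁ ⟧ v) i + ⟦ ι₂ ⟧ (⟦ π₂ ⟧ v) i ≈ v i

    hasDim-+ : ∀ {d₁ d₂} → HasDim S₁ d₁ → HasDim S₂ d₂ → HasDim T (d₁ +ℕ d₂)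
    hasDim-+ {d₁} {d₂} (b₁ , Zb₁ , independent₁ , spans₁) (b₂ , Zb₂ , independent₂ , spans₂) =
      b , Zb , independent , spans
      where
      b : Fin (d₁ +ℕ d₂) → I → C
      b = (λ j → ⟦ ι₁ ⟧ (b₁ j)) ++ (λ j → ⟦ ι₂ ⟧ (b₂ j))

      b-left : ∀ j i → b (j ↑ˡ d₂) i ≈ ⟦ ι₁ ⟧ (b₁ j) i
      b-left j i = ≈.reflexive (cong-app (lookup-++ˡ (λ j → ⟦ ι₁ ⟧ (b₁ j)) _ j) i)

      b-right : ∀ j i → b (d₁ ↑ʳ j) i ≈ ⟦ ι₂ ⟧ (b₂ j) i
      b-right j i = ≈.reflexive (cong-app (lookup-++ʳ (λ j → ⟦ ι₁ ⟧ (b₁ j)) _ j) i)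

      Zb : ∀ j → Z T (b j)
      Zb j with ↑-cases {d₁} j
      ... | inj₁ (j₁ , refl) = subst (Z T) (sym (lookup-++ˡ (λ j → ⟦ ι₁ ⟧ (b₁ j)) _ j₁)) (preserves-Z ι₁ _ (Zb₁ j₁))
      ... | inj₂ (j₂ , refl) = subst (Z T) (sym (lookup-++ʳ (λ j → ⟦ ι₁ ⟧ (b₁ j)) _ j₂)) (preserves-Z ι₂ _ (Zb₂ j₂))

      lin-split : ∀ {a'} {J : Set a'} (x : Fin (d₁ +ℕ d₂) → C) (w : Fin (d₁ +ℕ d₂) → J → C) i →
                  lin x w i ≈ lin (λ j → x (j ↑ˡ d₂)) (λ j → w (j ↑ˡ d₂)) i + lin (λ j → x (d₁ ↑ʳ j)) (λ j → w (d₁ ↑ʳ j)) i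
      lin-split x w i = ∑-split {d₁} (λ j → x j * w j i)

      π-lin : ∀ {a' z' y'} {I' : Set a'} {S : Subquotient I' z' y'} (π : SubquotientMap T S) {w₁ w₂} →
              (∀ j i → ⟦ π ⟧ (⟦ ι₁ ⟧ (b₁ j)) i ≈ w₁ j i) → (∀ j i → ⟦ π ⟧ (⟦ ι₂ ⟧ (b₂ j)) i ≈ w₂ j i) →
              ∀ x i → ⟦ π ⟧ (lin x b) i ≈ lin (λ j → x (j ↑ˡ d₂)) w₁ i + lin (λ j → x (d₁ ↑ʳ j)) w₂ i
      π-lin π left right x i =
        ≈.trans (apply-lin (linearMap π) x b i)
          (≈.trans (lin-split x (λ j → ⟦ π ⟧ (b j)) i)
            (+-cong (lin-cong _ (λ j i → ≈.trans (apply-cong (linearMap π) (b-left j) i) (left j i)) i)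
                    (lin-cong _ (λ j i → ≈.trans (apply-cong (linearMap π) (b-right j) i) (right j i)) i)))

      independent : ∀ x → B T (lin x b) → ∀ j → x j ≈ 0#
      independent x B-xb j with ↑-cases {d₁} j
      ... | inj₁ (j₁ , refl) = independent₁ (λ j → x (j ↑ˡ d₂)) (Subspace.closed-≈ (B-subspace S₁) first (preserves-B π₁ _ B-xb)) j₁
        where
        first : ∀ i → ⟦ π₁ ⟧ (lin x b) i ≈ lin (λ j → x (j ↑ˡ d₂)) b₁ i
        first i = ≈.trans (π-lin π₁ (λ j → π₁ι₁ _ (Zb₁ j)) (λ j → π₁ι₂ _ (Zb₂ j)) x i)
                          (≈.trans (+-congˡ (lin-0 (λ j → x (d₁ ↑ʳ j)) (λ _ _ → ≈.refl) i)) (+-identityʳ _))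
      ... | inj₂ (j₂ , refl) = independent₂ (λ j → x (d₁ ↑ʳ j)) (Subspace.closed-≈ (B-subspace S₂) second (preserves-B π₂ _ B-xb)) j₂
        where
        second : ∀ i → ⟦ π₂ ⟧ (lin x b) i ≈ lin (λ j → x (d₁ ↑ʳ j)) b₂ i
        second i = ≈.trans (π-lin π₂ (λ j → π₂ι₁ _ (Zb₁ j)) (λ j → π₂ι₂ _ (Zb₂ j)) x i)
                           (≈.trans (+-congʳ (lin-0 (λ j → x (j ↑ˡ d₂)) (λ _ _ → ≈.refl) i)) (+-identityˡ _))

      spans : ∀ v → Z T v → Σ (Fin (d₁ +ℕ d₂) → C) λ x → B T (λ i → v i - lin x b i)
      spans v Zv with spans₁ (⟦ π₁ ⟧ v) (preserves-Z π₁ v Zv) | spans₂ (⟦ π₂ ⟧ v) (preserves-Z π₂ v Zv)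
      ... | x₁ , B-residue₁ | x₂ , B-residue₂ =
        x₁ ++ x₂ , Subspace.closed-≈ (B-subspace T) recombine
                     (Subspace.closed-+ (B-subspace T) (preserves-B ι₁ _ B-residue₁) (preserves-B ι₂ _ B-residue₂))
        where
        L₁ L₂ : I → C
        L₁ = lin x₁ (λ j → ⟦ ι₁ ⟧ (b₁ j))
        L₂ = lin x₂ (λ j → ⟦ ι₂ ⟧ (b₂ j))
        lin-x₁++x₂ : ∀ i → lin (x₁ ++ x₂) b i ≈ L₁ i + L₂ i
        lin-x₁++x₂ i = ≈.trans (lin-split (x₁ ++ x₂) b i)
          (+-cong (≈.trans (lin-congˡ {b = λ j → b (j ↑ˡ d₂)} (λ j → ≈.reflexive (lookup-++ˡ x₁ x₂ j)) i) (lin-cong x₁ {b = λ j → b (j ↑ˡ d₂)} b-left i))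
                  (≈.trans (lin-congˡ {b = λ j → b (d₁ ↑ʳ j)} (λ j → ≈.reflexive (lookup-++ʳ x₁ x₂ j)) i) (lin-cong x₂ {b = λ j → b (d₁ ↑ʳ j)} b-right i)))
        recombine : ∀ i → ⟦ ι₁ ⟧ (λ i → ⟦ π₁ ⟧ v i - lin x₁ b₁ i) i + ⟦ ι₂ ⟧ (λ i → ⟦ π₂ ⟧ v i - lin x₂ b₂ i) i
                          ≈ v i - lin (x₁ ++ x₂) b i
        recombine i = begin
          ⟦ ι₁ ⟧ (λ i → ⟦ π₁ ⟧ v i - lin x₁ b₁ i) i + ⟦ ι₂ ⟧ (λ i → ⟦ π₂ ⟧ v i - lin x₂ b₂ i) i
            ≈⟨ +-cong (≈.trans (apply-- (linearMap ι₁) _ _ i) (+-congˡ (-‿cong (apply-lin (linearMap ι₁) x₁ b₁ i))))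
                      (≈.trans (apply-- (linearMap ι₂) _ _ i) (+-congˡ (-‿cong (apply-lin (linearMap ι₂) x₂ b₂ i)))) ⟩
          (⟦ ι₁ ⟧ (⟦ π₁ ⟧ v) i - L₁ i) + (⟦ ι₂ ⟧ (⟦ π₂ ⟧ v) i - L₂ i)
            ≈⟨ [a-b]+[c-d]≈[a+c]-[b+d] _ _ _ _ ⟩
          (⟦ ι₁ ⟧ (⟦ π₁ ⟧ v) i + ⟦ ι₂ ⟧ (⟦ π₂ ⟧ v) i) - (L₁ i + L₂ i)
            ≈⟨ +-cong (ι₁π₁+ι₂π₂ v Zv i) (-‿cong (≈.sym (lin-x₁++x₂ i))) ⟩
          v i - lin (x₁ ++ x₂) b i ∎

-- Cochains of coordinate sheaves

module Cochains {c ℓ} (F : Field c ℓ) where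
  open Field F hiding (refl; sym; trans; reflexive) renaming (Carrier to C)
  private module ≈ = Field F using (refl; sym; trans; reflexive)
  open Cohomology F
  open LinearAlgebra F
  open RingProperties ring using (-0#≈0#; -‿distribʳ-*; -1*x≈-x; -‿+-comm; -‿involutive)
  open SetoidReasoning setoid

  if-cong : ∀ (b : Bool) {x y x' y'} → x ≈ x' → y ≈ y' → (if b then x else y) ≈ (if b then x' else y')
  if-cong true  x≈x' _ = x≈x'
  if-cong false _ y≈y' = y≈y'

  if-hom : ∀ (b : Bool) (h : C → C) → h 0# ≈ 0# → ∀ x → (if b then h x else 0#) ≈ h (if b then x else 0#)
  if-hom true  h h-0 x = ≈.refl
  if-hom false h h-0 x = ≈.sym h-0

  if-+ : ∀ (b : Bool) x y → (if b then x + y else 0#) ≈ (if b then x else 0#) + (if b then y else 0#)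
  if-+ true  x y = ≈.refl
  if-+ false x y = ≈.sym (+-identityˡ 0#)

  if-0 : ∀ (b : Bool) {x} → x ≈ 0# → (if b then x else 0#) ≈ 0#
  if-0 true  x≈0 = x≈0
  if-0 false _   = ≈.refl

  module _ {K : SimplicialComplex} (S : CoordSheaf K) where
    open CoordSheaf S

    sgn-cong : ∀ t {a b} → a ≈ b → sgn S t a ≈ sgn S t b
    sgn-cong zero    a≈b = a≈b
    sgn-cong (suc t) a≈b = -‿cong (sgn-cong t a≈b)

    sgn-0 : ∀ t → sgn S t 0# ≈ 0#
    sgn-0 zero    = ≈.refl
    sgn-0 (suc t) = ≈.trans (-‿cong (sgn-0 t)) -0#≈0#

    sgn-+ : ∀ t a b → sgn S t (a + b) ≈ sgn S t a + sgn S t b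
    sgn-+ zero    a b = ≈.refl
    sgn-+ (suc t) a b = ≈.trans (-‿cong (sgn-+ t a b)) (≈.sym (-‿+-comm _ _))

    sgn-* : ∀ t a b → sgn S t (a * b) ≈ a * sgn S t b
    sgn-* zero    a b = ≈.refl
    sgn-* (suc t) a b = ≈.trans (-‿cong (sgn-* t a b)) (-‿distribʳ-* _ _)

    δ-sum : Cochain S → Subset (n K) → J → C
    δ-sum γ x j = ∑ (λ v → if ⌊ v ∈? x ⌋ then sgn S (pos S x v) (γ (x Sub.- v) (pull (x Sub.- v) j)) else 0#)

    δ-hom : (h : C → C) → (∀ {x y} → x ≈ y → h x ≈ h y) → h 0# ≈ 0# → (∀ x y → h (x + y) ≈ h x + h y) →
            (∀ t a → sgn S t (h a) ≈ h (sgn S t a)) →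
            ∀ (γ : Cochain S) x j → δ S (λ x j → h (γ x j)) x j ≈ h (δ S γ x j)
    δ-hom h h-cong h-0 h-+ h-sgn γ x j = ≈.trans
      (if-cong (isFace K x ∧ over x j)
        (≈.trans (∑.sum-cong {n K} (λ v → ≈.trans (if-cong ⌊ v ∈? x ⌋ (h-sgn (pos S x v) _) ≈.refl) (if-hom ⌊ v ∈? x ⌋ h h-0 _)))
                 (∑.sum-hom {n K} h h-cong h-0 h-+ _))
        ≈.refl)
      (if-hom (isFace K x ∧ over x j) h h-0 _)

    δ-cong : ∀ {γ η : Cochain S} → (∀ x j → γ x j ≈ η x j) → ∀ x j → δ S γ x j ≈ δ S η x j
    δ-cong γ≈η x j = if-cong (isFace K x ∧ over x j)
      (∑.sum-cong {n K} (λ v → if-cong ⌊ v ∈? x ⌋ (sgn-cong (pos S x v) (γ≈η _ _)) ≈.refl)) ≈.refl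

    δ-+ : ∀ (γ η : Cochain S) x j → δ S (λ x j → γ x j + η x j) x j ≈ δ S γ x j + δ S η x j
    δ-+ γ η x j = ≈.trans
      (if-cong (isFace K x ∧ over x j)
        (≈.trans (∑.sum-cong {n K} (λ v → ≈.trans (if-cong ⌊ v ∈? x ⌋ (sgn-+ (pos S x v) _ _) ≈.refl) (if-+ ⌊ v ∈? x ⌋ _ _)))
                 (∑.sum-+ {n K} _ _))
        ≈.refl)
      (if-+ (isFace K x ∧ over x j) _ _)

    δ-* : ∀ a (γ : Cochain S) x j → δ S (λ x j → a * γ x j) x j ≈ a * δ S γ x j
    δ-* a = δ-hom (a *_) *-congˡ (zeroʳ a) (distribˡ a) (λ t → sgn-* t a)

    δ-0 : ∀ (γ : Cochain S) → (∀ x j → γ x j ≈ 0#) → ∀ x j → δ S γ x j ≈ 0#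
    δ-0 γ γ≈0 x j = ≈.trans (δ-cong γ≈0 x j)
      (δ-hom (λ _ → 0#) (λ _ → ≈.refl) ≈.refl (λ _ _ → ≈.sym (+-identityˡ 0#)) (λ t _ → sgn-0 t) γ x j)

    δ-- : ∀ (γ η : Cochain S) x j → δ S (λ x j → γ x j - η x j) x j ≈ δ S γ x j - δ S η x j
    δ-- γ η x j = ≈.trans (δ-+ γ (λ x j → - η x j) x j)
      (+-congˡ (≈.trans (δ-cong (λ x j → ≈.sym (-1*x≈-x (η x j))) x j) (≈.trans (δ-* (- 1#) η x j) (-1*x≈-x _))))

    StalkSubspaces : Set (c ⊔ ℓ)
    StalkSubspaces = ∀ x → Subspace (sub x)

    module _ (stalks : StalkSubspaces) where

      isCochain-0 : ∀ k → IsCochain S k (λ _ _ → 0#)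
      isCochain-0 k = (λ _ _ _ → ≈.refl) , (λ x _ _ → Subspace.closed-0 (stalks x))

      isCochain-+ : ∀ k {γ η} → IsCochain S k γ → IsCochain S k η → IsCochain S k (λ x j → γ x j + η x j)
      isCochain-+ k (γ-supp , γ-sub) (η-supp , η-sub) =
        (λ x j ns → ≈.trans (+-cong (γ-supp x j ns) (η-supp x j ns)) (+-identityˡ 0#)) ,
        (λ x fx size → Subspace.closed-+ (stalks x) (γ-sub x fx size) (η-sub x fx size))

      isCochain-* : ∀ k a {γ} → IsCochain S k γ → IsCochain S k (λ x j → a * γ x j)
      isCochain-* k a (γ-supp , γ-sub) =
        (λ x j ns → ≈.trans (*-congˡ (γ-supp x j ns)) (zeroʳ a)) ,
        (λ x fx size → Subspace.closed-* (stalks x) a (γ-sub x fx size))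

      coboundaries : ∀ i → Subspace {I = Subset (n K) × J} (λ v → Coboundary S i (curry v))
      coboundaries i = record
        { closed-≈ = λ v≈w (η , η-cochain , δη≈v) → η , η-cochain , (λ x j → ≈.trans (δη≈v x j) (v≈w (x , j)))
        ; closed-0 = (λ _ _ → 0#) , isCochain-0 i , δ-0 _ (λ _ _ → ≈.refl)
        ; closed-+ = λ (η₁ , c₁ , d₁) (η₂ , c₂ , d₂) →
            (λ x j → η₁ x j + η₂ x j) , isCochain-+ i c₁ c₂ , (λ x j → ≈.trans (δ-+ η₁ η₂ x j) (+-cong (d₁ x j) (d₂ x j)))
        ; closed-* = λ a (η , c , d) →
            (λ x j → a * η x j) , isCochain-* i a c , (λ x j → ≈.trans (δ-* a η x j) (*-congˡ (d x j)))
        }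

      H : ℕ → Subquotient (Subset (n K) × J) ℓ (c ⊔ ℓ)
      H i = record
        { Z = λ v → Cocycle S i (curry v)
        ; B = λ v → Coboundary S i (curry v)
        ; B-subspace = coboundaries i
        }

  wholeStalks : ∀ {K} (S : CoordSheaf K) → (∀ x α → CoordSheaf.sub S x α) → StalkSubspaces S
  wholeStalks S all x = record
    { closed-≈ = λ _ _ → all x _ ; closed-0 = all x _ ; closed-+ = λ _ _ → all x _ ; closed-* = λ _ _ → all x _ }

  record CochainMap {K K' : SimplicialComplex} (S : CoordSheaf K) (S' : CoordSheaf K') : Set (c ⊔ ℓ) where
    field
      map         : Cochain S → Cochain S'
      map-cong    : ∀ {γ η} → (∀ x j → γ x j ≈ η x j) → ∀ x j → map γ x j ≈ map η x j
      map-+       : ∀ γ η x j → map (λ x j → γ x j + η x j) x j ≈ map γ x j + map η x j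
      map-*       : ∀ a γ x j → map (λ x j → a * γ x j) x j ≈ a * map γ x j
      map-cochain : ∀ k γ → IsCochain S k γ → IsCochain S' k (map γ)
      map-δ       : ∀ k γ → IsCochain S k γ → ∀ x j → δ S' (map γ) x j ≈ map (δ S γ) x j

    linear : LinearMap (Subset (n K) × CoordSheaf.J S) (Subset (n K') × CoordSheaf.J S')
    linear = record
      { apply = λ v → uncurry (map (curry v))
      ; apply-cong = λ v≈w (x , j) → map-cong (λ x j → v≈w (x , j)) x j
      ; apply-+ = λ v w (x , j) → map-+ (curry v) (curry w) x j
      ; apply-* = λ a v (x , j) → map-* a (curry v) x j
      }

    map-0 : ∀ x j → map (λ _ _ → 0#) x j ≈ 0#
    map-0 x j = apply-0 linear (x , j)

    onH : (stalks : StalkSubspaces S) (stalks' : StalkSubspaces S') → ∀ i → SubquotientMap (H S stalks i) (H S' stalks' i)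
    onH stalks stalks' i = record
      { linearMap = linear
      ; preserves-Z = λ v (v-cochain , δv≈0) →
          map-cochain (suc i) (curry v) v-cochain ,
          (λ x j → ≈.trans (map-δ (suc i) (curry v) v-cochain x j) (≈.trans (map-cong δv≈0 x j) (map-0 x j)))
      ; preserves-B = λ v (η , η-cochain , δη≈v) →
          map η , map-cochain i η η-cochain , (λ x j → ≈.trans (map-δ i η η-cochain x j) (map-cong δη≈v x j))
      }

  module _ {K : SimplicialComplex} (S : CoordSheaf K) where

    sgn-sgn : ∀ s t a → sgn S s (sgn S t a) ≡ sgn S (s +ℕ t) a
    sgn-sgn zero    t a = refl
    sgn-sgn (suc s) t a = cong -_ (sgn-sgn s t a)

    sgn-even : ∀ t k a → sgn S (t +ℕ 2 *ℕ k) a ≈ sgn S t a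
    sgn-even t zero    a = ≈.reflexive (cong (λ s → sgn S s a) (ℕₚ.+-identityʳ t))
    sgn-even t (suc k) a = ≈.trans (≈.reflexive (cong (λ s → sgn S s a) two-more)) (≈.trans (-‿involutive _) (sgn-even t k a))
      where
      two-more : t +ℕ 2 *ℕ suc k ≡ suc (suc (t +ℕ 2 *ℕ k))
      two-more = trans (ℕₚ.+-suc t _) (cong suc (trans (cong (t +ℕ_) (ℕₚ.+-suc k _)) (ℕₚ.+-suc t _)))

    sgn-1 : ∀ t a → sgn S t a ≈ sgn S t 1# * a
    sgn-1 t a = ≈.trans (sgn-cong S t (≈.sym (*-identityʳ a))) (≈.trans (sgn-* S t a 1#) (*-comm a _))

    sgn-1² : ∀ t → sgn S t 1# * sgn S t 1# ≈ 1#
    sgn-1² t = begin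
      sgn S t 1# * sgn S t 1#     ≈⟨ sgn-1 t (sgn S t 1#) ⟨
      sgn S t (sgn S t 1#)        ≡⟨ sgn-sgn t t 1# ⟩
      sgn S (t +ℕ t) 1#           ≡⟨ cong (λ s → sgn S (t +ℕ s) 1#) (sym (ℕₚ.+-identityʳ t)) ⟩
      sgn S (0 +ℕ 2 *ℕ t) 1#      ≈⟨ sgn-even 0 t 1# ⟩
      1#                          ∎

  δ-off-face : ∀ {K} (S : CoordSheaf K) (γ : Cochain S) {x} → ¬ T (isFace K x) → ∀ j → δ S γ x j ≈ 0#
  δ-off-face {K} S γ {x} ¬fx j with isFace K x
  ... | true  = ⊥-elim (¬fx _)
  ... | false = ≈.refl

-- Faces of a covering and the inversion count

∣p∣≡0⇒p≡∅ : ∀ {a} (s : Subset a) → ∣ s ∣ ≡ 0 → s ≡ ∅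
∣p∣≡0⇒p≡∅ []            _ = refl
∣p∣≡0⇒p≡∅ (outside ∷ s) e = cong (outside ∷_) (∣p∣≡0⇒p≡∅ s e)

∣p∣≡1⇒p≡⁅x⁆ : ∀ {a} (s : Subset a) → ∣ s ∣ ≡ 1 → ∃ λ v → s ≡ ⁅ v ⁆
∣p∣≡1⇒p≡⁅x⁆ (inside ∷ s)  e = Fin.zero , cong (inside ∷_) (∣p∣≡0⇒p≡∅ s (ℕₚ.suc-injective e))
∣p∣≡1⇒p≡⁅x⁆ (outside ∷ s) e with ∣p∣≡1⇒p≡⁅x⁆ s e
... | v , refl = Fin.suc v , refl

image-⁅⁆ : ∀ {a b} (f : Fin a → Fin b) v → image f ⁅ v ⁆ ≡ ⁅ f v ⁆
image-⁅⁆ f v = subset-ext λ w → ≡true-ext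
  (λ e → let (v' , v'∈ , fv'≡w) = !-image⁻ f ⁅ v ⁆ w e in
         trans (!-⁅⁆ (f v) w) (⌊⌋-true _ (trans (sym fv'≡w) (cong f (⌊⌋-sound (trans (sym (!-⁅⁆ v v')) v'∈))))))
  (λ e → subst (λ w → image f ⁅ v ⁆ ! w ≡ true) (sym (⌊⌋-sound (trans (sym (!-⁅⁆ (f v) w)) e)))
               (!-image⁺ f ⁅ v ⁆ v (trans (!-⁅⁆ v v) (⌊⌋-true _ refl))))

image-∪ : ∀ {a b} (f : Fin a → Fin b) s t → image f (s ∪ t) ≡ image f s ∪ image f t
image-∪ f s t = subset-ext λ w → trans (≡true-ext to from) (sym (!-∪ (image f s) (image f t) w))
  where
  to : ∀ {w} → image f (s ∪ t) ! w ≡ true → (image f s ! w ∨ image f t ! w) ≡ true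
  to {w} e with !-image⁻ f (s ∪ t) w e
  ... | v , v∈ , refl with s ! v in v∈s | t ! v in v∈t
  ...   | true  | _    = cong (_∨ _) (!-image⁺ f s v v∈s)
  ...   | false | true = trans (cong (image f s ! f v ∨_) (!-image⁺ f t v v∈t)) (∨-zeroʳ _)
  ...   | false | false with trans (sym v∈) (trans (!-∪ s t v) (cong₂ _∨_ v∈s v∈t))
  ...     | ()
  from : ∀ {w} → (image f s ! w ∨ image f t ! w) ≡ true → image f (s ∪ t) ! w ≡ true
  from {w} e with image f s ! w in w∈s
  ... | true with !-image⁻ f s w w∈s
  ...   | v , v∈ , refl = !-image⁺ f (s ∪ t) v (trans (!-∪ s t v) (cong (_∨ t ! v) v∈))
  from {w} e | false with !-image⁻ f t w e
  ...   | v , v∈ , refl = !-image⁺ f (s ∪ t) v (trans (!-∪ s t v) (trans (cong (s ! v ∨_) v∈) (∨-zeroʳ _)))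

_<ᵇ_ : ∀ {k} → Fin k → Fin k → Bool
a <ᵇ b = ⌊ a Fin.<? b ⌋

<ᵇ-irrefl : ∀ {k} (a : Fin k) → (a <ᵇ a) ≡ false
<ᵇ-irrefl a = ¬T⇒≡false (λ t → <-irrefl refl (⌊⌋-sound (T⇒≡true t)))

data Order {k} (a b : Fin k) : Set where
  less    : (a <ᵇ b) ≡ true → (b <ᵇ a) ≡ false → Order a b
  equal   : a ≡ b → Order a b
  greater : (a <ᵇ b) ≡ false → (b <ᵇ a) ≡ true → Order a b

order : ∀ {k} (a b : Fin k) → Order a b
order a b with <-cmp a b
... | tri< a<b _ b≮a = less (⌊⌋-true _ a<b) (¬T⇒≡false (λ t → b≮a (⌊⌋-sound (T⇒≡true t))))
... | tri≈ _ a≡b _   = equal a≡b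
... | tri> a≮b _ b<a = greater (¬T⇒≡false (λ t → a≮b (⌊⌋-sound (T⇒≡true t)))) (⌊⌋-true _ b<a)

module ℕSum = FiniteSums ℕₚ.+-0-commutativeMonoid
module ℕ∑ {k} = ℕSum.FiniteSum (ℕSum.finiteSum-Fin k)

indicator : Bool → ℕ
indicator b = if b then 1 else 0

∣p∣≡∑indicator : ∀ {a} (s : Subset a) → ∣ s ∣ ≡ ℕ∑.sum (λ v → indicator (s ! v))
∣p∣≡∑indicator []            = refl
∣p∣≡∑indicator (inside ∷ s)  = cong suc (∣p∣≡∑indicator s)
∣p∣≡∑indicator (outside ∷ s) = ∣p∣≡∑indicator s

position : ∀ {k} → Subset k → Fin k → ℕ
position s v = ∣ s ∩ tabulate (λ w → w <ᵇ v) ∣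

position≡∑ : ∀ {k} (s : Subset k) v → position s v ≡ ℕ∑.sum (λ b → indicator (s ! b ∧ b <ᵇ v))
position≡∑ s v = trans (∣p∣≡∑indicator (s ∩ tabulate (λ w → w <ᵇ v)))
  (ℕ∑.sum-cong (λ b → cong indicator (trans (!-∩ s _ b) (cong (s ! b ∧_) (!-tabulate (λ w → w <ᵇ v) b)))))

module CoveringGeometry {Y X : SimplicialComplex} (cov : Covering Y X) where
  open Nat using (_+_; _*_)
  private
    U = u cov

  over : Subset (n X) → Subset (n Y) → Bool
  over x y = isFace Y y ∧ (image U y ≟ˢ x)

  over⇒ : ∀ {x y} → over x y ≡ true → T (isFace Y y) × image U y ≡ x
  over⇒ {x} {y} e = ≡true⇒T (∧-conicalˡ _ _ e) , ⌊⌋-sound (∧-conicalʳ (isFace Y y) _ e)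

  ⇒over : ∀ {x y} → T (isFace Y y) → image U y ≡ x → over x y ≡ true
  ⇒over {y = y} fy refl rewrite T⇒≡true fy = ⌊⌋-true _ refl

  over⇒face : ∀ {x y} → over x y ≡ true → T (isFace X x)
  over⇒face e with over⇒ e
  ... | fy , refl = simplicial cov _ fy

  face-⊆ : ∀ (K : SimplicialComplex) {σ τ : Subset (n K)} → T (isFace K τ) →
           (∀ v → σ ! v ≡ true → τ ! v ≡ true) → ∃ (λ v → σ ! v ≡ true) → T (isFace K σ)
  face-⊆ K {σ} {τ} fτ σ⊆τ (v , v∈σ) = downward K σ τ fτ (λ w∈σ → !⇒∈ (σ⊆τ _ (∈⇒! w∈σ))) (v , !⇒∈ v∈σ)

  face-nonempty : ∀ (K : SimplicialComplex) {σ : Subset (n K)} → T (isFace K σ) → ∃ λ v → σ ! v ≡ true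
  face-nonempty K fσ with nonempty K _ fσ
  ... | v , v∈σ = v , ∈⇒! v∈σ

  -- {a} and {a, b} both contain a and have the same image, so local injectivity identifies them
  u-injective-on-face : ∀ {σ} → T (isFace Y σ) → ∀ a b → σ ! a ≡ true → σ ! b ≡ true → U a ≡ U b → a ≡ b
  u-injective-on-face {σ} fσ a b a∈σ b∈σ Ua≡Ub = sym (⌊⌋-sound (trans (sym (!-⁅⁆ a b)) b∈⁅a⁆))
    where
    pair = ⁅ a ⁆ ∪ ⁅ b ⁆
    a∈⁅a⁆ : ⁅ a ⁆ ! a ≡ true
    a∈⁅a⁆ = trans (!-⁅⁆ a a) (⌊⌋-true _ refl)
    a∈pair : pair ! a ≡ true
    a∈pair = trans (!-∪ ⁅ a ⁆ ⁅ b ⁆ a) (cong (_∨ ⁅ b ⁆ ! a) a∈⁅a⁆)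
    pair⊆σ : ∀ v → pair ! v ≡ true → σ ! v ≡ true
    pair⊆σ v v∈pair with ⁅ a ⁆ ! v in v∈⁅a⁆ | ⁅ b ⁆ ! v in v∈⁅b⁆
    ... | true  | _     = subst (λ w → σ ! w ≡ true) (sym (⌊⌋-sound (trans (sym (!-⁅⁆ a v)) v∈⁅a⁆))) a∈σ
    ... | false | true  = subst (λ w → σ ! w ≡ true) (sym (⌊⌋-sound (trans (sym (!-⁅⁆ b v)) v∈⁅b⁆))) b∈σ
    ... | false | false with trans (sym v∈pair) (trans (!-∪ ⁅ a ⁆ ⁅ b ⁆ v) (cong₂ _∨_ v∈⁅a⁆ v∈⁅b⁆))
    ...   | ()
    same-image : image U ⁅ a ⁆ ≡ image U pair
    same-image = sym (trans (image-∪ U ⁅ a ⁆ ⁅ b ⁆)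
      (trans (cong₂ _∪_ (image-⁅⁆ U a) (trans (image-⁅⁆ U b) (cong ⁅_⁆ (sym Ua≡Ub))))
             (trans (∪-idem ⁅ U a ⁆) (sym (image-⁅⁆ U a)))))
    b∈⁅a⁆ : ⁅ a ⁆ ! b ≡ true
    b∈⁅a⁆ = subst (λ s → s ! b ≡ true)
      (sym (local-inj cov a ⁅ a ⁆ pair (vertices Y a) (face-⊆ Y fσ pair⊆σ (a , a∈pair)) (!⇒∈ a∈⁅a⁆) (!⇒∈ a∈pair) same-image))
      (trans (!-∪ ⁅ a ⁆ ⁅ b ⁆ b) (trans (cong (⁅ a ⁆ ! b ∨_) (trans (!-⁅⁆ b b) (⌊⌋-true _ refl))) (∨-zeroʳ _)))



  module _ {c ℓ} (M : CommutativeMonoid c ℓ) where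
    open CommutativeMonoid M using (_≈_; ε)
    open FiniteSums M

    sum-image : ∀ {y} → T (isFace Y y) → (SY : FiniteSum (Fin (n Y))) (SX : FiniteSum (Fin (n X))) → ∀ g →
                FiniteSum.sum SY (λ v → if y ! v then g (U v) else ε) ≈ FiniteSum.sum SX (λ w → if image U y ! w then g w else ε)
    sum-image {y} fy SY SX = sum-reindex SY SX (y !_) (image U y !_) U
      (λ v v∈y → !-image⁺ U y v v∈y)
      (λ v v' v∈y v'∈y → u-injective-on-face fy v v' v∈y v'∈y)
      (λ w w∈Uy → let (v , v∈y , Uv≡w) = !-image⁻ U y w w∈Uy in v , v∈y , Uv≡w)

  ∣image∣≡∣∣ : ∀ {y} → T (isFace Y y) → ∣ image U y ∣ ≡ ∣ y ∣
  ∣image∣≡∣∣ {y} fy = sym (trans (∣p∣≡∑indicator y)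
    (trans (sum-image ℕₚ.+-0-commutativeMonoid fy (ℕSum.finiteSum-Fin _) (ℕSum.finiteSum-Fin _) (λ _ → 1)) (sym (∣p∣≡∑indicator (image U y)))))

  restrict : Subset (n X) → Subset (n Y) → Subset (n Y)
  restrict z y = y ∩ preimage U z

  !-restrict : ∀ z y v → restrict z y ! v ≡ (y ! v ∧ z ! U v)
  !-restrict z y v = trans (!-∩ y _ v) (cong (y ! v ∧_) (!-preimage U z v))

  image-restrict : ∀ z y w → image U (restrict z y) ! w ≡ (image U y ! w ∧ z ! w)
  image-restrict z y w = ≡true-ext to from
    where
    to : image U (restrict z y) ! w ≡ true → (image U y ! w ∧ z ! w) ≡ true
    to e with !-image⁻ U (restrict z y) w e
    ... | v , v∈ , refl rewrite !-image⁺ U y v (∧-conicalˡ _ _ (trans (sym (!-restrict z y v)) v∈)) =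
          ∧-conicalʳ (y ! v) _ (trans (sym (!-restrict z y v)) v∈)
    from : (image U y ! w ∧ z ! w) ≡ true → image U (restrict z y) ! w ≡ true
    from e with !-image⁻ U y w (∧-conicalˡ _ _ e)
    ... | v , v∈y , refl = !-image⁺ U _ v (trans (!-restrict z y v) (trans (cong (_∧ z ! U v) v∈y) (∧-conicalʳ (image U y ! U v) _ e)))

  module _ {x' z : Subset (n X)} (fz : T (isFace X z)) (z⊆x' : ∀ w → z ! w ≡ true → x' ! w ≡ true) where

    restrict-over : ∀ {y'} → over x' y' ≡ true → over z (restrict z y') ≡ true
    restrict-over {y'} y'-over with over⇒ y'-over
    ... | fy' , refl = ⇒over (face-⊆ Y fy' (λ v e → ∧-conicalˡ _ _ (trans (sym (!-∩ y' _ v)) e)) inhabited) image≡z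
      where
      image≡z : image U (restrict z y') ≡ z
      image≡z = subset-ext λ w → trans (image-restrict z y' w) (z-part w)
        where
        z-part : ∀ w → (image U y' ! w ∧ z ! w) ≡ z ! w
        z-part w with z ! w in w∈z
        ... | true  = trans (∧-identityʳ _) (z⊆x' w w∈z)
        ... | false = ∧-zeroʳ _
      inhabited : ∃ λ v → restrict z y' ! v ≡ true
      inhabited with face-nonempty X fz
      ... | w , w∈z with !-image⁻ U y' w (z⊆x' w w∈z)
      ...   | v , v∈y' , refl = v , trans (!-restrict z y' v) (trans (cong (_∧ z ! U v) v∈y') w∈z)

    restrict-injective : ∀ {y₁ y₂} → over x' y₁ ≡ true → over x' y₂ ≡ true → restrict z y₁ ≡ restrict z y₂ → y₁ ≡ y₂
    restrict-injective {y₁} {y₂} y₁-over y₂-over same with face-nonempty Y (proj₁ (over⇒ (restrict-over y₁-over)))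
    ... | v , v∈ = local-inj cov v y₁ y₂ (proj₁ (over⇒ y₁-over)) (proj₁ (over⇒ y₂-over))
                     (!⇒∈ (∧-conicalˡ _ _ (trans (sym (!-∩ y₁ _ v)) v∈)))
                     (!⇒∈ (∧-conicalˡ _ _ (trans (sym (!-∩ y₂ _ v)) (subst (λ t → t ! v ≡ true) same v∈))))
                     (trans (proj₂ (over⇒ y₁-over)) (sym (proj₂ (over⇒ y₂-over))))

    restrict-surjective : T (isFace X x') → ∀ {t} → over z t ≡ true → ∃ λ y' → over x' y' ≡ true × restrict z y' ≡ t
    restrict-surjective fx' {t} t-over with over⇒ t-over
    ... | ft , refl with face-nonempty Y ft
    ... | a , a∈t with local-surj cov a x' fx' (!⇒∈ (z⊆x' (U a) (!-image⁺ U _ a a∈t)))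
    ... | σ , fσ , a∈σ , σ-image = σ , σ-over ,
          local-inj cov a _ _ (proj₁ (over⇒ (restrict-over σ-over))) ft
            (!⇒∈ (trans (!-restrict z σ a) (trans (cong (_∧ z ! U a) (∈⇒! a∈σ)) (!-image⁺ U t a a∈t))))
            (!⇒∈ a∈t)
            (proj₂ (over⇒ (restrict-over σ-over)))
      where
      σ-over : over x' σ ≡ true
      σ-over = ⇒over fσ σ-image

    module _ {c ℓ} (M : CommutativeMonoid c ℓ) where
      open CommutativeMonoid M using (_≈_; ε)
      open FiniteSums M

      sum-restrict : T (isFace X x') → (S : FiniteSum (Subset (n Y))) → ∀ f →
                     FiniteSum.sum S (λ y' → if over x' y' then f (restrict z y') else ε) ≈
                     FiniteSum.sum S (λ y → if over z y then f y else ε)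
      sum-restrict fx' S = sum-reindex S S (over x') (over z) (restrict z)
        (λ y' → restrict-over) (λ y₁ y₂ → restrict-injective) (λ t → restrict-surjective fx')

  module _ {y : Subset (n Y)} (fy : T (isFace Y y)) {v : Fin (n Y)} (v∈y : y ! v ≡ true) where

    ≡ᵇ-on-face : ∀ b → y ! b ≡ true → (U b ≡ᵇ U v) ≡ (b ≡ᵇ v)
    ≡ᵇ-on-face b b∈y = ≡true-ext
      (λ e → ⌊⌋-true _ (u-injective-on-face fy b v b∈y v∈y (⌊⌋-sound e)))
      (λ e → ⌊⌋-true _ (cong U (⌊⌋-sound e)))

    restrict-minus : restrict (image U y Sub.- U v) y ≡ y Sub.- v
    restrict-minus = subset-ext λ b → trans (!-restrict (image U y Sub.- U v) y b)
      (trans (cong (y ! b ∧_) (!-- (image U y) (U v) (U b))) (sym (trans (!-- y v b) (kept-in-both b))))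
      where
      kept-in-both : ∀ b → (y ! b ∧ not (b ≡ᵇ v)) ≡ (y ! b ∧ (image U y ! U b ∧ not (U b ≡ᵇ U v)))
      kept-in-both b with y ! b in b∈y
      ... | false = refl
      ... | true rewrite !-image⁺ U y b b∈y | ≡ᵇ-on-face b b∈y = refl

    image-minus : image U (y Sub.- v) ≡ image U y Sub.- U v
    image-minus = trans (cong (image U) (sym restrict-minus)) (subset-ext λ w →
      trans (image-restrict (image U y Sub.- U v) y w)
      (trans (cong (image U y ! w ∧_) (!-- (image U y) (U v) w))
      (trans (sym (∧-assoc (image U y ! w) (image U y ! w) _))
      (trans (cong (_∧ not (w ≡ᵇ U v)) (∧-idem (image U y ! w))) (sym (!-- (image U y) (U v) w))))))

  inversion : Subset (n Y) → Fin (n Y) → Fin (n Y) → ℕ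
  inversion y a b = indicator (y ! a ∧ (y ! b ∧ (a <ᵇ b ∧ U b <ᵇ U a)))

  inversion-diagonal : ∀ y a → inversion y a a ≡ 0
  inversion-diagonal y a rewrite <ᵇ-irrefl a | ∧-zeroʳ (y ! a) | ∧-zeroʳ (y ! a) = refl

  inversions : Subset (n Y) → ℕ
  inversions y = ℕ∑.sum (λ a → ℕ∑.sum (λ b → inversion y a b))

  module _ {y : Subset (n Y)} (fy : T (isFace Y y)) {v : Fin (n Y)} (v∈y : y ! v ≡ true) where

    position-image : position (image U y) (U v) ≡ ℕ∑.sum (λ b → indicator (y ! b ∧ U b <ᵇ U v))
    position-image = trans (position≡∑ (image U y) (U v)) (trans (ℕ∑.sum-cong (λ w → if-indicator (image U y ! w) _))
      (trans (sym (sum-image ℕₚ.+-0-commutativeMonoid fy (ℕSum.finiteSum-Fin _) (ℕSum.finiteSum-Fin _) (λ w → indicator (w <ᵇ U v))))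
             (ℕ∑.sum-cong (λ b → sym (if-indicator (y ! b) _)))))
      where
      if-indicator : ∀ b c → indicator (b ∧ c) ≡ (if b then indicator c else 0)
      if-indicator true  c = refl
      if-indicator false c = refl

    v∉y-v : (y Sub.- v) ! v ≡ false
    v∉y-v = trans (!-- y v v) (trans (cong (λ z → y ! v ∧ not z) (⌊⌋-true _ refl)) (∧-zeroʳ _))

    y-v-keeps : ∀ a → (a ≡ᵇ v) ≡ false → (y Sub.- v) ! a ≡ y ! a
    y-v-keeps a a≢v = trans (!-- y v a) (trans (cong (λ z → y ! a ∧ not z) a≢v) (∧-identityʳ _))

    inversion-minus : ∀ a b → inversion y a b ≡
      inversion (y Sub.- v) a b + ((if a ≡ᵇ v then inversion y v b else 0) + (if b ≡ᵇ v then inversion y a v else 0))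
    inversion-minus a b with a ≡ᵇ v in a≡ᵇv | b ≡ᵇ v in b≡ᵇv
    ... | true  | true  rewrite ⌊⌋-sound {a? = a Fin.≟ v} a≡ᵇv | ⌊⌋-sound {a? = b Fin.≟ v} b≡ᵇv
                              | inversion-diagonal y v | inversion-diagonal (y Sub.- v) v = refl
    ... | true  | false rewrite ⌊⌋-sound {a? = a Fin.≟ v} a≡ᵇv | v∉y-v | ℕₚ.+-identityʳ (inversion y v b) = refl
    ... | false | true  rewrite ⌊⌋-sound {a? = b Fin.≟ v} b≡ᵇv | v∉y-v | ∧-zeroʳ ((y Sub.- v) ! a) = refl
    ... | false | false rewrite y-v-keeps a a≡ᵇv | y-v-keeps b b≡ᵇv | ℕₚ.+-identityʳ (inversion y a b) = refl

    inversions-minus : inversions y ≡ inversions (y Sub.- v) + (ℕ∑.sum (λ b → inversion y v b) + ℕ∑.sum (λ a → inversion y a v))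
    inversions-minus = begin
      ℕ∑.sum (λ a → ℕ∑.sum (λ b → inversion y a b))
        ≡⟨ ℕ∑.sum-cong (λ a → trans (ℕ∑.sum-cong (inversion-minus a)) (split (inversion (y Sub.- v) a) (row-term a) (column-term a))) ⟩
      ℕ∑.sum (λ a → ℕ∑.sum (inversion (y Sub.- v) a) + (ℕ∑.sum (row-term a) + ℕ∑.sum (column-term a)))
        ≡⟨ split (λ a → ℕ∑.sum (inversion (y Sub.- v) a)) (λ a → ℕ∑.sum (row-term a)) (λ a → ℕ∑.sum (column-term a)) ⟩
      inversions (y Sub.- v) + (ℕ∑.sum (λ a → ℕ∑.sum (row-term a)) + ℕ∑.sum (λ a → ℕ∑.sum (column-term a)))
        ≡⟨ cong (inversions (y Sub.- v) +_) (cong₂ _+_ row column) ⟩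
      inversions (y Sub.- v) + (ℕ∑.sum (λ b → inversion y v b) + ℕ∑.sum (λ a → inversion y a v)) ∎
      where
      open ≡-Reasoning
      row-term column-term : Fin (n Y) → Fin (n Y) → ℕ
      row-term a b = if a ≡ᵇ v then inversion y v b else 0
      column-term a b = if b ≡ᵇ v then inversion y a v else 0
      split : (f g h : Fin (n Y) → ℕ) → ℕ∑.sum (λ i → f i + (g i + h i)) ≡ ℕ∑.sum f + (ℕ∑.sum g + ℕ∑.sum h)
      split f g h = trans (ℕ∑.sum-+ f _) (cong (ℕ∑.sum f +_) (ℕ∑.sum-+ g h))
      row : ℕ∑.sum (λ a → ℕ∑.sum (row-term a)) ≡ ℕ∑.sum (λ b → inversion y v b)
      row = trans (ℕ∑.sum-cong (λ a → pull-out (a ≡ᵇ v))) (ℕ∑.sum-δ v (λ _ → ℕ∑.sum (λ b → inversion y v b)))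
        where
        pull-out : ∀ c → ℕ∑.sum (λ b → if c then inversion y v b else 0) ≡ (if c then ℕ∑.sum (λ b → inversion y v b) else 0)
        pull-out true  = refl
        pull-out false = ℕ∑.sum-0 {n Y}
      column : ℕ∑.sum (λ a → ℕ∑.sum (column-term a)) ≡ ℕ∑.sum (λ a → inversion y a v)
      column = ℕ∑.sum-cong (λ a → ℕ∑.sum-δ v (λ _ → inversion y a v))

    below-in-both : ℕ
    below-in-both = ℕ∑.sum (λ b → indicator (y ! b ∧ (b <ᵇ v ∧ U b <ᵇ U v)))

    -- b forms an inversion with v exactly when it lies below v in one order but not the other
    inversion-with : ∀ b → inversion y v b + inversion y b v + 2 * indicator (y ! b ∧ (b <ᵇ v ∧ U b <ᵇ U v))
                           ≡ indicator (y ! b ∧ b <ᵇ v) + indicator (y ! b ∧ U b <ᵇ U v)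
    inversion-with b with y ! b in b∈y
    ... | false rewrite v∈y = refl
    ... | true rewrite v∈y with order b v
    ...   | equal refl rewrite <ᵇ-irrefl b | <ᵇ-irrefl (U b) = refl
    ...   | less b<v v≮b rewrite b<v | v≮b with order (U b) (U v)
    ...     | less Ub<Uv Uv≮Ub rewrite Ub<Uv | Uv≮Ub = refl
    ...     | greater Ub≮Uv Uv<Ub rewrite Ub≮Uv | Uv<Ub = refl
    ...     | equal Ub≡Uv with u-injective-on-face fy b v b∈y v∈y Ub≡Uv
    ...       | refl with trans (sym b<v) (<ᵇ-irrefl b)
    ...         | ()
    inversion-with b | true | greater b≮v v<b rewrite b≮v | v<b with order (U b) (U v)
    ...     | less Ub<Uv Uv≮Ub rewrite Ub<Uv = refl
    ...     | greater Ub≮Uv Uv<Ub rewrite Ub≮Uv = refl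
    ...     | equal Ub≡Uv with u-injective-on-face fy b v b∈y v∈y Ub≡Uv
    ...       | refl with trans (sym v<b) (<ᵇ-irrefl b)
    ...         | ()

    inversions-through : ℕ∑.sum (λ b → inversion y v b) + ℕ∑.sum (λ a → inversion y a v) + 2 * below-in-both
                         ≡ position y v + position (image U y) (U v)
    inversions-through = begin
      ℕ∑.sum (λ b → inversion y v b) + ℕ∑.sum (λ a → inversion y a v) + 2 * below-in-both
        ≡⟨ cong₂ _+_ (sym (ℕ∑.sum-+ (λ b → inversion y v b) (λ b → inversion y b v)))
                     (sym (ℕ∑.sum-hom (2 *_) (cong (2 *_)) refl (ℕₚ.*-distribˡ-+ 2) (λ b → indicator (y ! b ∧ (b <ᵇ v ∧ U b <ᵇ U v))))) ⟩
      ℕ∑.sum (λ b → inversion y v b + inversion y b v) + ℕ∑.sum (λ b → 2 * indicator (y ! b ∧ (b <ᵇ v ∧ U b <ᵇ U v)))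
        ≡⟨ sym (ℕ∑.sum-+ (λ b → inversion y v b + inversion y b v) (λ b → 2 * indicator (y ! b ∧ (b <ᵇ v ∧ U b <ᵇ U v)))) ⟩
      ℕ∑.sum (λ b → inversion y v b + inversion y b v + 2 * indicator (y ! b ∧ (b <ᵇ v ∧ U b <ᵇ U v)))
        ≡⟨ trans (ℕ∑.sum-cong inversion-with) (ℕ∑.sum-+ (λ b → indicator (y ! b ∧ b <ᵇ v)) (λ b → indicator (y ! b ∧ U b <ᵇ U v))) ⟩
      ℕ∑.sum (λ b → indicator (y ! b ∧ b <ᵇ v)) + ℕ∑.sum (λ b → indicator (y ! b ∧ U b <ᵇ U v))
        ≡⟨ cong₂ _+_ (sym (position≡∑ y v)) (sym position-image) ⟩
      position y v + position (image U y) (U v) ∎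
      where open ≡-Reasoning

    inversion-parity : inversions y + position y v + 2 * below-in-both
                       ≡ position (image U y) (U v) + inversions (y Sub.- v) + 2 * position y v
    inversion-parity = begin
      inversions y + position y v + 2 * below-in-both
        ≡⟨ cong (λ i → i + position y v + 2 * below-in-both) inversions-minus ⟩
      inversions (y Sub.- v) + (through-v + through-v') + position y v + 2 * below-in-both
        ≡⟨ solve 5 (λ i t t' p d → i :+ (t :+ t') :+ p :+ con 2 :* d := i :+ p :+ (t :+ t' :+ con 2 :* d)) refl
                   (inversions (y Sub.- v)) through-v through-v' (position y v) below-in-both ⟩
      inversions (y Sub.- v) + position y v + (through-v + through-v' + 2 * below-in-both)
        ≡⟨ cong (inversions (y Sub.- v) + position y v +_) inversions-through ⟩
      inversions (y Sub.- v) + position y v + (position y v + position (image U y) (U v))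
        ≡⟨ solve 3 (λ i p q → i :+ p :+ (p :+ q) := q :+ i :+ con 2 :* p) refl
                   (inversions (y Sub.- v)) (position y v) (position (image U y) (U v)) ⟩
      position (image U y) (U v) + inversions (y Sub.- v) + 2 * position y v ∎
      where
      open ≡-Reasoning
      open +-*-Solver
      through-v through-v' : ℕ
      through-v = ℕ∑.sum (λ b → inversion y v b)
      through-v' = ℕ∑.sum (λ a → inversion y a v)

  inversions-⁅⁆ : ∀ a → inversions ⁅ a ⁆ ≡ 0
  inversions-⁅⁆ a = trans (ℕ∑.sum-cong (λ b → trans (ℕ∑.sum-cong (no-inversion b)) (ℕ∑.sum-0 {n Y}))) (ℕ∑.sum-0 {n Y})
    where
    no-inversion : ∀ b c → inversion ⁅ a ⁆ b c ≡ 0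
    no-inversion b c with ⁅ a ⁆ ! b in b∈ | ⁅ a ⁆ ! c in c∈
    ... | false | _     = refl
    ... | true  | false = refl
    ... | true  | true with ⌊⌋-sound {a? = b Fin.≟ a} (trans (sym (!-⁅⁆ a b)) b∈) | ⌊⌋-sound {a? = c Fin.≟ a} (trans (sym (!-⁅⁆ a c)) c∈)
    ...   | refl | refl rewrite <ᵇ-irrefl b = refl

module ClosedZeroCochains {c ℓ} (F : Field c ℓ) (K : SimplicialComplex) where
  open Field F hiding (refl; sym; trans; reflexive) renaming (Carrier to C)
  private module ≈ = Field F using (refl; sym; trans; reflexive)
  open Cohomology F
  open LinearAlgebra F
  open Cochains F
  open RingProperties ring using (x∙y⁻¹≈ε⇒x≈y)

  CK : CoordSheaf K
  CK = constSheaf K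

  module _ (β : Cochain CK) (closed : ∀ y → δ CK β y tt ≈ 0#) where

    -- on the edge {a, b}, δβ = ±(β{b} − β{a}), the sign depending on the order of a and b
    edge-constant : ∀ a b → T (isFace K (⁅ a ⁆ ∪ ⁅ b ⁆)) → β ⁅ a ⁆ tt ≈ β ⁅ b ⁆ tt
    edge-constant a b f-ab with a Fin.≟ b
    ... | yes refl = ≈.refl
    ... | no a≢b = by-order (order a b)
      where
      pair = ⁅ a ⁆ ∪ ⁅ b ⁆
      term : Fin (n K) → C
      term v = sgn CK (pos CK pair v) (β (pair Sub.- v) tt)
      !-pair : ∀ v → pair ! v ≡ (v ≡ᵇ a ∨ v ≡ᵇ b)
      !-pair v = ≡.trans (!-∪ ⁅ a ⁆ ⁅ b ⁆ v) (≡.cong₂ _∨_ (!-⁅⁆ a v) (!-⁅⁆ b v))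
      not-both : ∀ v → (v ≡ᵇ a) ≡ true → (v ≡ᵇ b) ≡ true → ⊥
      not-both v v≡a v≡b = a≢b (≡.trans (≡.sym (⌊⌋-sound v≡a)) (⌊⌋-sound v≡b))
      two-terms : ∀ v → (if ⌊ v ∈? pair ⌋ then term v else 0#) ≈ (if v ≡ᵇ a then term v else 0#) + (if v ≡ᵇ b then term v else 0#)
      two-terms v rewrite ∈?≡! v pair | !-pair v with v ≡ᵇ a in v≡a | v ≡ᵇ b in v≡b
      ... | true  | true  = ⊥-elim (not-both v v≡a v≡b)
      ... | true  | false = ≈.sym (+-identityʳ _)
      ... | false | _     = ≈.sym (+-identityˡ _)
      δ-pair : term a + term b ≈ 0#
      δ-pair = ≈.trans (≈.sym (≈.trans (∑.sum-cong two-terms) (≈.trans (∑.sum-+ {n K} _ _) (+-cong (∑.sum-δ a term) (∑.sum-δ b term)))))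
                       (≈.trans (≈.reflexive (≡.cong (λ t → if t ∧ true then δ-sum CK β pair tt else 0#) (≡.sym (T⇒≡true f-ab)))) (closed pair))
      position-pair : ∀ v → pos CK pair v ≡ indicator (a <ᵇ v) +ℕ indicator (b <ᵇ v)
      position-pair v = ≡.trans (position≡∑ pair v)
        (≡.trans (ℕ∑.sum-cong by-vertex) (≡.trans (ℕ∑.sum-+ {n K} _ _) (≡.cong₂ _+ℕ_ (ℕ∑.sum-δ a (λ w → indicator (w <ᵇ v))) (ℕ∑.sum-δ b (λ w → indicator (w <ᵇ v))))))
        where
        by-vertex : ∀ w → indicator (pair ! w ∧ w <ᵇ v) ≡ (if w ≡ᵇ a then indicator (w <ᵇ v) else 0) +ℕ (if w ≡ᵇ b then indicator (w <ᵇ v) else 0)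
        by-vertex w rewrite !-pair w with w ≡ᵇ a in w≡a | w ≡ᵇ b in w≡b
        ... | true  | true  = ⊥-elim (not-both w w≡a w≡b)
        ... | true  | false = ≡.sym (ℕₚ.+-identityʳ _)
        ... | false | true  = refl
        ... | false | false = refl
      term-a : term a ≈ sgn CK (indicator (b <ᵇ a)) (β ⁅ b ⁆ tt)
      term-a = ≈.reflexive (≡.cong₂ (λ t s → sgn CK t (β s tt))
        (≡.trans (position-pair a) (≡.cong (λ z → indicator z +ℕ indicator (b <ᵇ a)) (<ᵇ-irrefl a))) (⁅c⁆∪⁅d⁆-c≡⁅d⁆ a b a≢b))
      term-b : term b ≈ sgn CK (indicator (a <ᵇ b)) (β ⁅ a ⁆ tt)
      term-b = ≈.reflexive (≡.cong₂ (λ t s → sgn CK t (β s tt))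
        (≡.trans (position-pair b) (≡.trans (≡.cong (λ z → indicator (a <ᵇ b) +ℕ indicator z) (<ᵇ-irrefl b)) (ℕₚ.+-identityʳ _)))
        (≡.trans (≡.cong (Sub._- b) (∪-comm ⁅ a ⁆ ⁅ b ⁆)) (⁅c⁆∪⁅d⁆-c≡⁅d⁆ b a (λ b≡a → a≢b (≡.sym b≡a)))))
      by-order : Order a b → β ⁅ a ⁆ tt ≈ β ⁅ b ⁆ tt
      by-order (less a<b b≮a) = ≈.sym (x∙y⁻¹≈ε⇒x≈y _ _ (≈.trans (≈.sym (+-cong
        (≈.trans term-a (≈.reflexive (≡.cong (λ t → sgn CK (indicator t) (β ⁅ b ⁆ tt)) b≮a)))
        (≈.trans term-b (≈.reflexive (≡.cong (λ t → sgn CK (indicator t) (β ⁅ a ⁆ tt)) a<b))))) δ-pair))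
      by-order (equal a≡b) = ⊥-elim (a≢b a≡b)
      by-order (greater a≮b b<a) = x∙y⁻¹≈ε⇒x≈y _ _ (≈.trans (≈.sym (+-cong
        (≈.trans term-b (≈.reflexive (≡.cong (λ t → sgn CK (indicator t) (β ⁅ a ⁆ tt)) a≮b)))
        (≈.trans term-a (≈.reflexive (≡.cong (λ t → sgn CK (indicator t) (β ⁅ b ⁆ tt)) b<a))))) (≈.trans (+-comm _ _) δ-pair))

    path-constant : ∀ a b → Reach K a b → β ⁅ a ⁆ tt ≈ β ⁅ b ⁆ tt
    path-constant a .a (here .a) = ≈.refl
    path-constant a b (step .a v .b f-av v⇝b) = ≈.trans (edge-constant a v f-av) (path-constant v b v⇝b)

-- The pushforward u_*F_Y and its decompositions

module Pushforward {c ℓ} (F : Field c ℓ) {Y X : SimplicialComplex} (cov : Covering Y X) where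
  open Field F hiding (refl; sym; trans; reflexive) renaming (Carrier to C)
  private module ≈ = Field F using (refl; sym; trans; reflexive)
  open Cohomology F
  open LinearAlgebra F
  open Cochains F
  open CoveringGeometry cov
  open FiniteSums +-commutativeMonoid using (FiniteSum; subsetSum; finiteSum-Subset; sum-transport; sum-reindex)
  open RingProperties ring using (-0#≈0#; -‿distribʳ-*; -‿involutive; -‿+-comm; -1*x≈-x; x[y-z]≈xy-xz)
  open CommutativeSemigroupProperties *-commutativeSemigroup using (x∙yz≈y∙xz)
  open SetoidReasoning setoid

  U = u cov

  ∑ˢ≡subsetSum : ∀ {a} (g : Subset a → C) → ∑ˢ g ≡ subsetSum g
  ∑ˢ≡subsetSum {zero}  g = refl
  ∑ˢ≡subsetSum {suc a} g = ≡.cong₂ _+_ (∑ˢ≡subsetSum {a} _) (∑ˢ≡subsetSum {a} _)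

  finiteSum∑ˢ : ∀ a → FiniteSum (Subset a)
  finiteSum∑ˢ a = sum-transport (finiteSum-Subset a) ∑ˢ ∑ˢ≡subsetSum

  module ∑ˢ = FiniteSum (finiteSum∑ˢ (n Y))

  pushforward : CoordSheaf X
  pushforward = record { J = Subset (n Y) ; over = over ; pull = restrict ; sub = λ _ _ → Level.Lift ℓ ⊤ }

  G : CoordSheaf X
  G = kerSheaf cov

  CX : CoordSheaf X
  CX = constSheaf X

  CY : CoordSheaf Y
  CY = constSheaf Y

  minus-⊆ : ∀ {a} (x : Subset a) w w' → (x Sub.- w) ! w' ≡ true → x ! w' ≡ true
  minus-⊆ x w w' e = ∧-conicalˡ _ _ (≡.trans (≡.sym (!-- x w w')) e)

  fibre-sum : Subset (n X) → (Subset (n Y) → C) → C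
  fibre-sum x g = ∑ˢ (λ y → if over x y then g y else 0#)

  fibre-sum-cong : ∀ x {g h} → (∀ y → g y ≈ h y) → fibre-sum x g ≈ fibre-sum x h
  fibre-sum-cong x g≈h = ∑ˢ.sum-cong (λ y → if-cong (over x y) (g≈h y) ≈.refl)

  fibre-sum-hom : ∀ x (h : C → C) → (∀ {a b} → a ≈ b → h a ≈ h b) → h 0# ≈ 0# → (∀ a b → h (a + b) ≈ h a + h b) →
                  ∀ g → fibre-sum x (λ y → h (g y)) ≈ h (fibre-sum x g)
  fibre-sum-hom x h h-cong h-0 h-+ g =
    ≈.trans (∑ˢ.sum-cong (λ y → if-hom (over x y) h h-0 (g y))) (∑ˢ.sum-hom h h-cong h-0 h-+ _)

  fibre-sum-+ : ∀ x g h → fibre-sum x (λ y → g y + h y) ≈ fibre-sum x g + fibre-sum x h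
  fibre-sum-+ x g h = ≈.trans (∑ˢ.sum-cong (λ y → if-+ (over x y) _ _)) (∑ˢ.sum-+ _ _)

  fibre-sum-* : ∀ x a g → fibre-sum x (λ y → a * g y) ≈ a * fibre-sum x g
  fibre-sum-* x a = fibre-sum-hom x (a *_) *-congˡ (zeroʳ a) (distribˡ a)

  fibre-sum-- : ∀ x g h → fibre-sum x (λ y → g y - h y) ≈ fibre-sum x g - fibre-sum x h
  fibre-sum-- x g h = ≈.trans (fibre-sum-+ x g _) (+-congˡ (fibre-sum-hom x -_ -‿cong -0#≈0# (λ a b → ≈.sym (-‿+-comm a b)) h))

  fibre-sum-off-face : ∀ {x} → ¬ T (isFace X x) → ∀ g → fibre-sum x g ≈ 0#
  fibre-sum-off-face {x} ¬fx g = ≈.trans (∑ˢ.sum-cong empty-fibre) ∑ˢ.sum-0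
    where
    empty-fibre : ∀ y → (if over x y then g y else 0#) ≈ 0#
    empty-fibre y with over x y in y-over
    ... | true  = ⊥-elim (¬fx (over⇒face y-over))
    ... | false = ≈.refl

  G-stalks : StalkSubspaces G
  G-stalks x = record
    { closed-≈ = λ α≈β Σα≈0 → ≈.trans (≈.sym (fibre-sum-cong x α≈β)) Σα≈0
    ; closed-0 = ≈.trans (∑ˢ.sum-cong (λ y → if-0 (over x y) ≈.refl)) ∑ˢ.sum-0
    ; closed-+ = λ Σα≈0 Σβ≈0 → ≈.trans (fibre-sum-+ x _ _) (≈.trans (+-cong Σα≈0 Σβ≈0) (+-identityˡ 0#))
    ; closed-* = λ a Σα≈0 → ≈.trans (fibre-sum-* x a _) (≈.trans (*-congˡ Σα≈0) (zeroʳ a))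
    }

  P-stalks : StalkSubspaces pushforward
  P-stalks = wholeStalks pushforward (λ _ _ → Level.lift tt)

  CX-stalks : StalkSubspaces CX
  CX-stalks = wholeStalks CX (λ _ _ → Level.lift tt)

  CY-stalks : StalkSubspaces CY
  CY-stalks = wholeStalks CY (λ _ _ → Level.lift tt)

  off-face : ∀ {K} (S : CoordSheaf K) {k} {γ : Cochain S} → IsCochain S k γ → ∀ z j → ¬ T (isFace K z) → γ z j ≈ 0#
  off-face {K} S γ-cochain z j ¬fz = proj₁ γ-cochain z j (λ t → ¬fz (proj₁ (T-∧⁻ {isFace K z} t)))

  off-fibre : ∀ {k} {γ : Cochain pushforward} → IsCochain pushforward k γ → ∀ x y → over x y ≡ false → γ x y ≈ 0#
  off-fibre {k} γ-cochain x y y∉ = proj₁ γ-cochain x y (λ t → y∉-over (proj₂ (T-∧⁻ {⌊ ∣ x ∣ Nat.≟ k ⌋} (proj₂ (T-∧⁻ {isFace X x} t)))))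
    where
    y∉-over : ¬ T (over x y)
    y∉-over t with ≡.trans (≡.sym y∉) (T⇒≡true t)
    ... | ()

  over⇒size : ∀ {x y} → over x y ≡ true → ∣ x ∣ ≡ ∣ y ∣
  over⇒size y-over with over⇒ y-over
  ... | fy , refl = ∣image∣≡∣∣ fy

  image-sum : ∀ {y' x'} → T (isFace Y y') → image U y' ≡ x' → ∀ (g : Fin (n X) → C) →
              ∑ (λ w → if ⌊ w ∈? x' ⌋ then g w else 0#) ≈ ∑ (λ v → if ⌊ v ∈? y' ⌋ then g (U v) else 0#)
  image-sum {y'} {x'} fy refl g = begin
    ∑ (λ w → if ⌊ w ∈? x' ⌋ then g w else 0#)      ≈⟨ ∑.sum-cong (λ w → if-∈? w x') ⟩
    ∑ (λ w → if x' ! w then g w else 0#)           ≈⟨ sum-image +-commutativeMonoid fy (finiteSum∑ (n Y)) (finiteSum∑ (n X)) g ⟨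
    ∑ (λ v → if y' ! v then g (U v) else 0#)       ≈⟨ ∑.sum-cong (λ v → ≈.sym (if-∈? v y')) ⟩
    ∑ (λ v → if ⌊ v ∈? y' ⌋ then g (U v) else 0#) ∎
    where
    if-∈? : ∀ {a} (w : Fin a) (s : Subset a) {c : C} → (if ⌊ w ∈? s ⌋ then c else 0#) ≈ (if s ! w then c else 0#)
    if-∈? w s {c} = ≈.reflexive (≡.cong (λ b → if b then c else 0#) (∈?≡! w s))

  diagonal : CochainMap CX pushforward
  diagonal = record
    { map = diag
    ; map-cong = λ γ≈η x y → if-cong (over x y) (γ≈η x tt) ≈.refl
    ; map-+ = λ γ η x y → if-+ (over x y) _ _
    ; map-* = λ a γ x y → if-hom (over x y) (a *_) (zeroʳ a) _
    ; map-cochain = λ k γ γ-cochain → supported γ-cochain , (λ _ _ _ → Level.lift tt)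
    ; map-δ = λ k γ γ-cochain → commutes γ (off-face CX γ-cochain)
    }
    where
    diag : Cochain CX → Cochain pushforward
    diag γ x y = if over x y then γ x tt else 0#
    supported : ∀ {k γ} → IsCochain CX k γ → ∀ x y → ¬ T (supp pushforward k x y) → diag γ x y ≈ 0#
    supported {γ = γ} γ-cochain x y ns with over x y
    ... | false = ≈.refl
    ... | true  = proj₁ γ-cochain x tt ns
    commutes : ∀ γ → (∀ z j → ¬ T (isFace X z) → γ z j ≈ 0#) → ∀ x' y' →
               (if isFace X x' ∧ over x' y' then δ-sum pushforward (diag γ) x' y' else 0#)
               ≈ (if over x' y' then (if isFace X x' ∧ true then δ-sum CX γ x' tt else 0#) else 0#)
    commutes γ γ-off x' y' with over x' y' in y'-over
    ... | false rewrite ∧-zeroʳ (isFace X x') = ≈.refl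
    ... | true rewrite T⇒≡true (over⇒face y'-over) = ∑.sum-cong term
      where
      term : ∀ w → (if ⌊ w ∈? x' ⌋ then sgn pushforward (pos pushforward x' w) (diag γ (x' Sub.- w) (restrict (x' Sub.- w) y')) else 0#)
                   ≈ (if ⌊ w ∈? x' ⌋ then sgn CX (pos CX x' w) (γ (x' Sub.- w) tt) else 0#)
      term w with ⌊ w ∈? x' ⌋
      ... | false = ≈.refl
      ... | true  = sgn-cong pushforward (pos pushforward x' w) restricted
        where
        restricted : diag γ (x' Sub.- w) (restrict (x' Sub.- w) y') ≈ γ (x' Sub.- w) tt
        restricted with over (x' Sub.- w) (restrict (x' Sub.- w) y') in restricted-over
        ... | true  = ≈.refl
        ... | false = ≈.sym (γ-off (x' Sub.- w) tt (λ fz → false≢true (≡.trans (≡.sym restricted-over) (restrict-over fz (minus-⊆ x' w) y'-over))))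

  -- the sign of the permutation relating the vertex orders of y and of u(y)
  ε : Subset (n Y) → C
  ε y = sgn CY (inversions y) 1#

  ε-ε : ∀ y a → ε y * (ε y * a) ≈ a
  ε-ε y a = ≈.trans (≈.sym (*-assoc _ _ _)) (≈.trans (*-congʳ (sgn-1² CY (inversions y))) (*-identityˡ a))

  -- ε turns the signs in δ on X into those on Y; this is where inversion-parity enters
  ε-twists-sign : ∀ {y'} → T (isFace Y y') → ∀ {v} → y' ! v ≡ true → ∀ g →
                  sgn CY (position (image U y') (U v)) (ε (y' Sub.- v) * g) ≈ ε y' * sgn CY (position y' v) g
  ε-twists-sign {y'} fy {v} v∈y' g = begin
    sgn CY t₁ (sgn CY i' 1# * g)                   ≈⟨ ≈.trans (sgn-cong CY t₁ (*-comm _ g)) (≈.trans (sgn-* CY t₁ g _) (*-comm g _)) ⟩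
    sgn CY t₁ (sgn CY i' 1#) * g                   ≡⟨ ≡.cong (_* g) (sgn-sgn CY t₁ i' 1#) ⟩
    sgn CY (t₁ +ℕ i') 1# * g                       ≈⟨ *-congʳ (sgn-even CY (t₁ +ℕ i') t₂ 1#) ⟨
    sgn CY (t₁ +ℕ i' +ℕ 2 *ℕ t₂) 1# * g            ≡⟨ ≡.cong (λ s → sgn CY s 1# * g) (≡.sym (inversion-parity fy v∈y')) ⟩
    sgn CY (i +ℕ t₂ +ℕ 2 *ℕ below-in-both fy v∈y') 1# * g ≈⟨ *-congʳ (sgn-even CY (i +ℕ t₂) (below-in-both fy v∈y') 1#) ⟩
    sgn CY (i +ℕ t₂) 1# * g                        ≡⟨ ≡.cong (_* g) (≡.sym (sgn-sgn CY i t₂ 1#)) ⟩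
    sgn CY i (sgn CY t₂ 1#) * g                    ≈⟨ *-congʳ (sgn-1 CY i _) ⟩
    (sgn CY i 1# * sgn CY t₂ 1#) * g               ≈⟨ *-assoc _ _ _ ⟩
    sgn CY i 1# * (sgn CY t₂ 1# * g)               ≈⟨ *-congˡ (sgn-1 CY t₂ g) ⟨
    sgn CY i 1# * sgn CY t₂ g                      ∎
    where
    t₁ = position (image U y') (U v)
    t₂ = position y' v
    i  = inversions y'
    i' = inversions (y' Sub.- v)

  twist-map : Cochain CY → Cochain pushforward
  twist-map γ x y = if over x y then ε y * γ y tt else 0#

  untwist-map : Cochain pushforward → Cochain CY
  untwist-map γ y _ = ε y * γ (image U y) y

  twist-δ : ∀ {k} (γ : Cochain CY) → IsCochain CY k γ → ∀ x' y' →
            (if isFace X x' ∧ over x' y' then δ-sum pushforward (twist-map γ) x' y' else 0#)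
            ≈ (if over x' y' then ε y' * (if isFace Y y' ∧ true then δ-sum CY γ y' tt else 0#) else 0#)
  twist-δ γ γ-cochain x' y' with over x' y' in y'-over
  ... | false rewrite ∧-zeroʳ (isFace X x') = ≈.refl
  ... | true with over⇒ y'-over
  ...   | fy , refl rewrite T⇒≡true (simplicial cov y' fy) | T⇒≡true fy = begin
    ∑ (λ w → if ⌊ w ∈? image U y' ⌋ then g w else 0#)                  ≈⟨ image-sum fy refl g ⟩
    ∑ (λ v → if ⌊ v ∈? y' ⌋ then g (U v) else 0#)                      ≈⟨ ∑.sum-cong term ⟩
    ∑ (λ v → ε y' * (if ⌊ v ∈? y' ⌋ then sgn CY (pos CY y' v) (γ (y' Sub.- v) tt) else 0#)) ≈⟨ ∑-scaleˡ (ε y') (λ v → if ⌊ v ∈? y' ⌋ then sgn CY (pos CY y' v) (γ (y' Sub.- v) tt) else 0#) ⟩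
    ε y' * δ-sum CY γ y' tt                                             ∎
    where
    g : Fin (n X) → C
    g w = sgn pushforward (pos pushforward (image U y') w)
            (twist-map γ (image U y' Sub.- w) (restrict (image U y' Sub.- w) y'))
    term : ∀ v → (if ⌊ v ∈? y' ⌋ then g (U v) else 0#)
                 ≈ ε y' * (if ⌊ v ∈? y' ⌋ then sgn CY (pos CY y' v) (γ (y' Sub.- v) tt) else 0#)
    term v with ⌊ v ∈? y' ⌋ in v∈?y'
    ... | false = ≈.sym (zeroʳ _)
    ... | true  = begin
      g (U v)                                             ≡⟨ ≡.cong (λ y → sgn pushforward t (twist-map γ x-v y)) (restrict-minus fy v∈y') ⟩
      sgn pushforward t (twist-map γ x-v (y' Sub.- v))    ≈⟨ sgn-cong pushforward t face-term ⟩
      sgn CY t (ε (y' Sub.- v) * γ (y' Sub.- v) tt)       ≈⟨ ε-twists-sign fy v∈y' _ ⟩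
      ε y' * sgn CY (pos CY y' v) (γ (y' Sub.- v) tt)     ∎
      where
      t = position (image U y') (U v)
      x-v = image U y' Sub.- U v
      v∈y' : y' ! v ≡ true
      v∈y' = ≡.trans (≡.sym (∈?≡! v y')) v∈?y'
      face-term : twist-map γ (image U y' Sub.- U v) (y' Sub.- v) ≈ ε (y' Sub.- v) * γ (y' Sub.- v) tt
      face-term with over (image U y' Sub.- U v) (y' Sub.- v) in over-minus
      ... | true  = ≈.refl
      ... | false = ≈.sym (≈.trans (*-congˡ (off-face CY γ-cochain (y' Sub.- v) tt not-face)) (zeroʳ _))
        where
        not-face : ¬ T (isFace Y (y' Sub.- v))
        not-face f = false≢true (≡.trans (≡.sym over-minus) (⇒over f (image-minus fy v∈y')))

  twist : CochainMap CY pushforward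
  twist = record
    { map = twist-map
    ; map-cong = λ γ≈η x y → if-cong (over x y) (*-congˡ (γ≈η y tt)) ≈.refl
    ; map-+ = λ γ η x y → ≈.trans (if-cong (over x y) (distribˡ _ _ _) ≈.refl) (if-+ (over x y) _ _)
    ; map-* = λ a γ x y → ≈.trans (if-cong (over x y) (x∙yz≈y∙xz _ _ _) ≈.refl) (if-hom (over x y) (a *_) (zeroʳ a) _)
    ; map-cochain = λ k γ γ-cochain → supported γ-cochain , (λ _ _ _ → Level.lift tt)
    ; map-δ = λ k γ γ-cochain → twist-δ γ γ-cochain
    }
    where
    supported : ∀ {k γ} → IsCochain CY k γ → ∀ x y → ¬ T (supp pushforward k x y) → twist-map γ x y ≈ 0#
    supported {k} γ-cochain x y ns with over x y in y-over
    ... | false = ≈.refl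
    ... | true  = ≈.trans (*-congˡ (proj₁ γ-cochain y tt (λ t → ns (lift-support t)))) (zeroʳ _)
      where
      lift-support : T (supp CY k y tt) → T (isFace X x ∧ (⌊ ∣ x ∣ Nat.≟ k ⌋ ∧ true))
      lift-support t = T-∧⁺ (over⇒face y-over)
        (≡.subst (λ s → T (⌊ s Nat.≟ k ⌋ ∧ true)) (≡.sym (over⇒size y-over)) (proj₂ (T-∧⁻ {isFace Y y} t)))

  untwist-twist : ∀ (γ : Cochain CY) → (∀ y → ¬ T (isFace Y y) → γ y tt ≈ 0#) → ∀ y j → untwist-map (twist-map γ) y j ≈ γ y j
  untwist-twist γ γ-off y j with isFace Y y in fy
  ... | true rewrite ⌊⌋-true (≡-dec Bool._≟_ (image U y) (image U y)) refl = ε-ε y _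
  ... | false = ≈.trans (zeroʳ _) (≈.sym (γ-off y (λ t → false≢true (≡.trans (≡.sym fy) (T⇒≡true t)))))

  twist-untwist : ∀ (γ : Cochain pushforward) → (∀ x y → over x y ≡ false → γ x y ≈ 0#) → ∀ x y → twist-map (untwist-map γ) x y ≈ γ x y
  twist-untwist γ γ-off x y with over x y in y-over
  ... | false = ≈.sym (γ-off x y y-over)
  ... | true with over⇒ y-over
  ...   | _ , refl = ε-ε y _

  untwist-supported : ∀ {k γ} → IsCochain pushforward k γ → ∀ y j → ¬ T (supp CY k y j) → untwist-map γ y j ≈ 0#
  untwist-supported {k} {γ} γ-cochain y j ns = ≈.trans (*-congˡ (proj₁ γ-cochain (image U y) y (λ t → ns (lower-support t)))) (zeroʳ _)
    where
    lower-support : T (supp pushforward k (image U y) y) → T (supp CY k y j)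
    lower-support t with over (image U y) y in y-over
    ... | true = T-∧⁺ (proj₁ (over⇒ y-over))
                   (≡.subst (λ s → T (⌊ s Nat.≟ k ⌋ ∧ true)) (over⇒size y-over) (proj₂ (T-∧⁻ {isFace X (image U y)} t)))
    ... | false with isFace X (image U y) | ⌊ ∣ image U y ∣ Nat.≟ k ⌋
    lower-support () | false | true  | true
    lower-support () | false | true  | false
    lower-support () | false | false | _

  untwist : CochainMap pushforward CY
  untwist = record
    { map = untwist-map
    ; map-cong = λ γ≈η y _ → *-congˡ (γ≈η (image U y) y)
    ; map-+ = λ γ η y _ → distribˡ _ _ _
    ; map-* = λ a γ y _ → x∙yz≈y∙xz _ _ _
    ; map-cochain = λ k γ γ-cochain → untwist-supported γ-cochain , (λ _ _ _ → Level.lift tt)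
    ; map-δ = commutes
    }
    where
    -- transported from twist-δ, since untwist inverts twist
    commutes : ∀ k γ → IsCochain pushforward k γ → ∀ y j → δ CY (untwist-map γ) y j ≈ untwist-map (δ pushforward γ) y j
    commutes k γ γ-cochain y j = begin
      δ CY (untwist-map γ) y j
        ≈⟨ untwist-twist (δ CY (untwist-map γ)) (λ y ¬fy → δ-off-face CY (untwist-map γ) ¬fy tt) y j ⟨
      untwist-map (twist-map (δ CY (untwist-map γ))) y j
        ≈⟨ *-congˡ (CochainMap.map-δ twist k (untwist-map γ) (untwist-supported γ-cochain , (λ _ _ _ → Level.lift tt)) (image U y) y) ⟨
      untwist-map (δ pushforward (twist-map (untwist-map γ))) y j
        ≈⟨ *-congˡ (δ-cong pushforward (twist-untwist γ (off-fibre γ-cochain)) (image U y) y) ⟩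
      untwist-map (δ pushforward γ) y j ∎

  H-pushforward⇒H-Y : ∀ i {d} → HasDim (H pushforward P-stalks i) d → HasH CY i d
  H-pushforward⇒H-Y i = hasDim-iso (CochainMap.onH untwist P-stalks CY-stalks i) (CochainMap.onH twist CY-stalks P-stalks i)
    (λ v (v-cochain , _) (x , y) → twist-untwist (curry v) (off-fibre v-cochain) x y)
    (λ v (v-cochain , _) (y , j) → untwist-twist (curry v) (λ y ¬fy → off-face CY v-cochain y tt ¬fy) y j)

  restricted-fibre-sum : ∀ {x' z} → T (isFace X x') → (∀ w → z ! w ≡ true → x' ! w ≡ true) → ∀ {k} (γ : Cochain pushforward) →
                         IsCochain pushforward k γ → ∑ˢ (λ y' → if over x' y' then γ z (restrict z y') else 0#) ≈ fibre-sum z (γ z)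
  restricted-fibre-sum {x'} {z} fx' z⊆x' γ γ-cochain with isFace X z in fz
  ... | true  = sum-restrict (≡true⇒T fz) z⊆x' +-commutativeMonoid fx' (finiteSum∑ˢ (n Y)) (γ z)
  ... | false = ≈.trans (∑ˢ.sum-cong (λ y' → if-0 (over x' y') (off-face pushforward γ-cochain z _ ¬fz)))
                        (≈.trans ∑ˢ.sum-0 (≈.sym (fibre-sum-off-face ¬fz (γ z))))
    where
    ¬fz : ¬ T (isFace X z)
    ¬fz t = false≢true (≡.trans (≡.sym fz) (T⇒≡true t))

  module Transfer (m : ℕ) (deg : HasDegree cov m) (m≉0 : ¬ (ι m ≈ 0#)) where

    μ : C
    μ = proj₁ (inverse (ι m) m≉0)

    μ*m≈1 : μ * ι m ≈ 1#
    μ*m≈1 = ≈.trans (*-comm _ _) (proj₂ (inverse (ι m) m≉0))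

    μ*[m*a]≈a : ∀ a → μ * (ι m * a) ≈ a
    μ*[m*a]≈a a = ≈.trans (≈.sym (*-assoc _ _ _)) (≈.trans (*-congʳ μ*m≈1) (*-identityˡ a))

    ∑-const : ∀ k a → ∑ {k} (λ _ → a) ≈ ι k * a
    ∑-const zero    a = ≈.sym (zeroˡ a)
    ∑-const (suc k) a = ≈.trans (+-cong (≈.sym (*-identityˡ a)) (∑-const k a)) (≈.sym (distribʳ a 1# (ι k)))

    fibre-sum-const : ∀ {x} → T (isFace X x) → ∀ a → fibre-sum x (λ _ → a) ≈ ι m * a
    fibre-sum-const {x} fx a with deg x fx
    ... | pre , pre-injective , pre-over , pre-onto = ≈.trans (≈.sym (sum-reindex (finiteSum∑ m) (finiteSum∑ˢ (n Y))
            (λ _ → true) (over x) pre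
            (λ i _ → ⇒over (proj₁ (pre-over i)) (proj₂ (pre-over i)))
            (λ i i' _ _ → pre-injective)
            (λ y y-over → let (i , pre-i≡y) = pre-onto y (proj₁ (over⇒ y-over)) (proj₂ (over⇒ y-over)) in i , refl , pre-i≡y)
            (λ _ → a)))
          (∑-const m a)

    average-map : Cochain pushforward → Cochain CX
    average-map γ x _ = μ * fibre-sum x (γ x)

    average-δ : ∀ {k} (γ : Cochain pushforward) → IsCochain pushforward k γ → ∀ x' →
                (if isFace X x' ∧ true then δ-sum CX (average-map γ) x' tt else 0#)
                ≈ μ * fibre-sum x' (λ y' → if isFace X x' ∧ over x' y' then δ-sum pushforward γ x' y' else 0#)
    average-δ γ γ-cochain x' with isFace X x' in fx'
    ... | false = ≈.sym (≈.trans (*-congˡ (∑ˢ.sum-cong (λ y' → if-0 (over x' y') ≈.refl))) (≈.trans (*-congˡ ∑ˢ.sum-0) (zeroʳ μ)))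
    ... | true  = ≈.sym (begin
      μ * ∑ˢ (λ y' → if over x' y' then (if over x' y' then ∑ (term y') else 0#) else 0#)
        ≈⟨ *-congˡ (∑ˢ.sum-cong (λ y' → ≈.trans (if-idem (over x' y')) (if-∑ (over x' y') (term y')))) ⟩
      μ * ∑ˢ (λ y' → ∑ (λ w → if over x' y' then term y' w else 0#))
        ≈⟨ *-congˡ (∑ˢ.sum-comm (∑.summation {n X}) _) ⟩
      μ * ∑ (λ w → ∑ˢ (λ y' → if over x' y' then term y' w else 0#))
        ≈⟨ ∑-scaleˡ {n X} μ _ ⟨
      ∑ (λ w → μ * ∑ˢ (λ y' → if over x' y' then term y' w else 0#))
        ≈⟨ ∑.sum-cong averaged-term ⟩
      δ-sum CX (average-map γ) x' tt ∎)
      where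
      term : Subset (n Y) → Fin (n X) → C
      term y' w = if ⌊ w ∈? x' ⌋ then sgn pushforward (pos pushforward x' w) (γ (x' Sub.- w) (restrict (x' Sub.- w) y')) else 0#
      if-idem : ∀ b {a} → (if b then (if b then a else 0#) else 0#) ≈ (if b then a else 0#)
      if-idem true  = ≈.refl
      if-idem false = ≈.refl
      if-∑ : ∀ b (f : Fin (n X) → C) → (if b then ∑ f else 0#) ≈ ∑ (λ w → if b then f w else 0#)
      if-∑ true  f = ≈.refl
      if-∑ false f = ≈.sym (∑.sum-0 {n X})
      averaged-term : ∀ w → μ * ∑ˢ (λ y' → if over x' y' then term y' w else 0#)
                          ≈ (if ⌊ w ∈? x' ⌋ then sgn CX (pos CX x' w) (average-map γ (x' Sub.- w) tt) else 0#)
      averaged-term w with ⌊ w ∈? x' ⌋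
      ... | false = ≈.trans (*-congˡ (∑ˢ.sum-cong (λ y' → if-0 (over x' y') ≈.refl))) (≈.trans (*-congˡ ∑ˢ.sum-0) (zeroʳ μ))
      ... | true  = begin
        μ * fibre-sum x' (λ y' → sgn pushforward t (γ z (restrict z y')))
          ≈⟨ *-congˡ (fibre-sum-hom x' (sgn pushforward t) (sgn-cong pushforward t) (sgn-0 pushforward t) (sgn-+ pushforward t) _) ⟩
        μ * sgn pushforward t (fibre-sum x' (λ y' → γ z (restrict z y')))
          ≈⟨ *-congˡ (sgn-cong pushforward t (restricted-fibre-sum (≡true⇒T fx') (minus-⊆ x' w) γ γ-cochain)) ⟩
        μ * sgn pushforward t (fibre-sum z (γ z))
          ≈⟨ sgn-* pushforward t μ _ ⟨
        sgn CX (pos CX x' w) (average-map γ z tt) ∎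
        where
        z = x' Sub.- w
        t = pos pushforward x' w

    average : CochainMap pushforward CX
    average = record
      { map = average-map
      ; map-cong = λ γ≈η x _ → *-congˡ (fibre-sum-cong x (γ≈η x))
      ; map-+ = λ γ η x _ → ≈.trans (*-congˡ (fibre-sum-+ x _ _)) (distribˡ μ _ _)
      ; map-* = λ a γ x _ → ≈.trans (*-congˡ (fibre-sum-* x a _)) (x∙yz≈y∙xz _ _ _)
      ; map-cochain = λ k γ γ-cochain → supported γ-cochain , (λ _ _ _ → Level.lift tt)
      ; map-δ = λ k γ γ-cochain x _ → average-δ γ γ-cochain x
      }
      where
      supported : ∀ {k γ} → IsCochain pushforward k γ → ∀ x j → ¬ T (supp CX k x j) → average-map γ x j ≈ 0#
      supported {k} {γ} γ-cochain x j ns = ≈.trans (*-congˡ (≈.trans (∑ˢ.sum-cong outside-support) ∑ˢ.sum-0)) (zeroʳ μ)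
        where
        outside-support : ∀ y → (if over x y then γ x y else 0#) ≈ 0#
        outside-support y with over x y in y-over
        ... | false = ≈.refl
        ... | true  = proj₁ γ-cochain x y (λ t → ns (≡.subst (λ b → T (isFace X x ∧ (⌊ ∣ x ∣ Nat.≟ k ⌋ ∧ b))) y-over t))

    inclusion : CochainMap G pushforward
    inclusion = record
      { map = λ γ → γ
      ; map-cong = λ γ≈η → γ≈η
      ; map-+ = λ _ _ _ _ → ≈.refl
      ; map-* = λ _ _ _ _ → ≈.refl
      ; map-cochain = λ k γ γ-cochain → proj₁ γ-cochain , (λ _ _ _ → Level.lift tt)
      ; map-δ = λ _ _ _ _ _ → ≈.refl
      }

    private
      module diagonal = CochainMap diagonal
      module average = CochainMap average

    projection-map : Cochain pushforward → Cochain G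
    projection-map γ x y = γ x y - diagonal.map (average.map γ) x y

    projection-in-kernel : ∀ (γ : Cochain pushforward) x → T (isFace X x) → fibre-sum x (projection-map γ x) ≈ 0#
    projection-in-kernel γ x fx = begin
      fibre-sum x (λ y → γ x y - (if over x y then a else 0#))              ≈⟨ fibre-sum-- x _ _ ⟩
      fibre-sum x (γ x) - fibre-sum x (λ y → if over x y then a else 0#)    ≈⟨ +-congˡ (-‿cong (∑ˢ.sum-cong (λ y → if-idem (over x y)))) ⟩
      fibre-sum x (γ x) - fibre-sum x (λ _ → a)                             ≈⟨ +-congˡ (-‿cong (fibre-sum-const fx a)) ⟩
      fibre-sum x (γ x) - ι m * (μ * fibre-sum x (γ x))                      ≈⟨ +-congˡ (-‿cong (≈.trans (x∙yz≈y∙xz _ _ _) (μ*[m*a]≈a _))) ⟩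
      fibre-sum x (γ x) - fibre-sum x (γ x)                                 ≈⟨ -‿inverseʳ _ ⟩
      0# ∎
      where
      a = average.map γ x tt
      if-idem : ∀ b → (if b then (if b then a else 0#) else 0#) ≈ (if b then a else 0#)
      if-idem true  = ≈.refl
      if-idem false = ≈.refl

    projection : CochainMap pushforward G
    projection = record
      { map = projection-map
      ; map-cong = λ γ≈η x y → +-cong (γ≈η x y) (-‿cong (diagonal.map-cong (average.map-cong γ≈η) x y))
      ; map-+ = λ γ η x y → ≈.trans (+-congˡ (-‿cong (diag-avg-+ γ η x y))) (≈.sym ([a-b]+[c-d]≈[a+c]-[b+d] _ _ _ _))
      ; map-* = λ a γ x y → ≈.trans (+-congˡ (-‿cong (diag-avg-* a γ x y))) (≈.sym (x[y-z]≈xy-xz a _ _))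
      ; map-cochain = λ k γ γ-cochain → supported γ-cochain , (λ x fx _ → projection-in-kernel γ x fx)
      ; map-δ = commutes
      }
      where
      diag-avg-+ : ∀ γ η x y → diagonal.map (average.map (λ x y → γ x y + η x y)) x y
                               ≈ diagonal.map (average.map γ) x y + diagonal.map (average.map η) x y
      diag-avg-+ γ η x y = ≈.trans (diagonal.map-cong (average.map-+ γ η) x y) (diagonal.map-+ (average.map γ) (average.map η) x y)
      diag-avg-* : ∀ a γ x y → diagonal.map (average.map (λ x y → a * γ x y)) x y ≈ a * diagonal.map (average.map γ) x y
      diag-avg-* a γ x y = ≈.trans (diagonal.map-cong (average.map-* a γ) x y) (diagonal.map-* a (average.map γ) x y)
      supported : ∀ {k γ} → IsCochain pushforward k γ → ∀ x y → ¬ T (supp G k x y) → projection-map γ x y ≈ 0#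
      supported {k} {γ} γ-cochain x y ns =
        ≈.trans (+-cong (proj₁ γ-cochain x y ns) (-‿cong (proj₁ (diagonal.map-cochain k _ (average.map-cochain k γ γ-cochain)) x y ns)))
                (≈.trans (+-identityˡ _) -0#≈0#)
      commutes : ∀ k γ → IsCochain pushforward k γ → ∀ x y → δ G (projection-map γ) x y ≈ projection-map (δ pushforward γ) x y
      commutes k γ γ-cochain x y = begin
        δ pushforward (λ x y → γ x y - diagonal.map (average.map γ) x y) x y
          ≈⟨ δ-- pushforward γ (diagonal.map (average.map γ)) x y ⟩
        δ pushforward γ x y - δ pushforward (diagonal.map (average.map γ)) x y
          ≈⟨ +-congˡ (-‿cong (diagonal.map-δ k _ (average.map-cochain k γ γ-cochain) x y)) ⟩
        δ pushforward γ x y - diagonal.map (δ CX (average.map γ)) x y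
          ≈⟨ +-congˡ (-‿cong (diagonal.map-cong (average.map-δ k γ γ-cochain) x y)) ⟩
        δ pushforward γ x y - diagonal.map (average.map (δ pushforward γ)) x y ∎

    average-kernel : ∀ {k γ} → IsCochain G k γ → ∀ x → average.map γ x tt ≈ 0#
    average-kernel {k} {γ} γ-cochain x with isFace X x in fx
    ... | false = ≈.trans (*-congˡ (fibre-sum-off-face (λ t → false≢true (≡.trans (≡.sym fx) (T⇒≡true t))) (γ x))) (zeroʳ μ)
    ... | true with ∣ x ∣ Nat.≟ k
    ...   | yes size = ≈.trans (*-congˡ (proj₂ γ-cochain x (≡true⇒T fx) size)) (zeroʳ μ)
    ...   | no ¬size = ≈.trans (*-congˡ (≈.trans (∑ˢ.sum-cong (λ y → if-0 (over x y) (proj₁ γ-cochain x y (wrong-size y)))) ∑ˢ.sum-0)) (zeroʳ μ)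
      where
      wrong-size : ∀ y → ¬ T (supp G k x y)
      wrong-size y t = ¬size (⌊⌋-sound {a? = ∣ x ∣ Nat.≟ k} (T⇒≡true (proj₁ (T-∧⁻ {⌊ ∣ x ∣ Nat.≟ k ⌋} (proj₂ (T-∧⁻ {isFace X x} t))))))

    average-diagonal : ∀ {k γ} → IsCochain CX k γ → ∀ x → average.map (diagonal.map γ) x tt ≈ γ x tt
    average-diagonal {k} {γ} γ-cochain x with isFace X x in fx
    ... | true  = ≈.trans (*-congˡ (≈.trans (∑ˢ.sum-cong (λ y → if-idem (over x y))) (fibre-sum-const (≡true⇒T fx) (γ x tt))))
                          (μ*[m*a]≈a _)
      where
      if-idem : ∀ b → (if b then (if b then γ x tt else 0#) else 0#) ≈ (if b then γ x tt else 0#)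
      if-idem true  = ≈.refl
      if-idem false = ≈.refl
    ... | false = ≈.trans (*-congˡ (fibre-sum-off-face ¬fx _)) (≈.trans (zeroʳ μ) (≈.sym (off-face CX γ-cochain x tt ¬fx)))
      where
      ¬fx : ¬ T (isFace X x)
      ¬fx t = false≢true (≡.trans (≡.sym fx) (T⇒≡true t))

    splitting : ∀ i → DirectSum (H G G-stalks i) (H CX CX-stalks i) (H pushforward P-stalks i)
    splitting i = record
      { ι₁ = CochainMap.onH inclusion G-stalks P-stalks i
      ; ι₂ = CochainMap.onH diagonal CX-stalks P-stalks i
      ; π₁ = CochainMap.onH projection P-stalks G-stalks i
      ; π₂ = CochainMap.onH average P-stalks CX-stalks i
      ; π₁ι₁ = λ v (v-cochain , _) (x , y) →
          ≈.trans (+-congˡ (≈.trans (-‿cong (diagonal.map-cong (λ x _ → average-kernel v-cochain x) x y))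
                                    (≈.trans (-‿cong (if-0 (over x y) ≈.refl)) -0#≈0#)))
                  (+-identityʳ _)
      ; π₂ι₁ = λ v (v-cochain , _) (x , _) → average-kernel v-cochain x
      ; π₁ι₂ = λ v (v-cochain , _) (x , y) →
          ≈.trans (+-congˡ (-‿cong (diagonal.map-cong (λ x _ → average-diagonal v-cochain x) x y))) (-‿inverseʳ _)
      ; π₂ι₂ = λ v (v-cochain , _) (x , _) → average-diagonal v-cochain x
      ; ι₁π₁+ι₂π₂ = λ v _ (x , y) → ≈.trans (+-assoc _ _ _) (≈.trans (+-congˡ (-‿inverseˡ _)) (+-identityʳ _))
      }

    kernel-cocycle⁰-vanishes : Connected Y → ∀ γ → Cocycle G 0 γ → ∀ x j → γ x j ≈ 0#
    kernel-cocycle⁰-vanishes (0<n , connected) γ (γ-cochain , δγ≈0) = vanishes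
      where
      γ-cochain' : IsCochain pushforward 1 γ
      γ-cochain' = CochainMap.map-cochain inclusion 1 γ γ-cochain
      β : Cochain CY
      β = untwist-map γ
      β-closed : ∀ y → δ CY β y tt ≈ 0#
      β-closed y = ≈.trans (CochainMap.map-δ untwist 1 γ γ-cochain' y tt) (≈.trans (*-congˡ (δγ≈0 (image U y) y)) (zeroʳ _))
      y₀ : Fin (n Y)
      y₀ = Fin.fromℕ< 0<n
      c₀ : C
      c₀ = β ⁅ y₀ ⁆ tt
      β-constant : ∀ a → β ⁅ a ⁆ tt ≈ c₀
      β-constant a = ClosedZeroCochains.path-constant F Y β β-closed a y₀ (connected a y₀)
      ε-⁅⁆ : ∀ a → ε ⁅ a ⁆ ≈ 1#
      ε-⁅⁆ a = ≈.reflexive (≡.cong (λ t → sgn CY t 1#) (inversions-⁅⁆ a))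
      on-vertex : ∀ x j → over x j ≡ true → ∣ x ∣ ≡ 1 → γ x j ≈ c₀
      on-vertex x j j-over size with ∣p∣≡1⇒p≡⁅x⁆ j (≡.trans (≡.sym (over⇒size j-over)) size)
      ... | a , refl = begin
        γ x ⁅ a ⁆             ≈⟨ twist-untwist γ (off-fibre γ-cochain') x ⁅ a ⁆ ⟨
        twist-map β x ⁅ a ⁆   ≡⟨ ≡.cong (λ b → if b then ε ⁅ a ⁆ * β ⁅ a ⁆ tt else 0#) j-over ⟩
        ε ⁅ a ⁆ * β ⁅ a ⁆ tt  ≈⟨ *-cong (ε-⁅⁆ a) (β-constant a) ⟩
        1# * c₀               ≈⟨ *-identityˡ c₀ ⟩
        c₀                    ∎
      x₀ : Subset (n X)
      x₀ = ⁅ U y₀ ⁆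
      -- the fibre over a vertex has m points, all carrying c₀, and sums to 0
      c₀≈0 : c₀ ≈ 0#
      c₀≈0 = begin
        c₀                          ≈⟨ μ*[m*a]≈a c₀ ⟨
        μ * (ι m * c₀)              ≈⟨ *-congˡ (fibre-sum-const (vertices X (U y₀)) c₀) ⟨
        μ * fibre-sum x₀ (λ _ → c₀) ≈⟨ *-congˡ (∑ˢ.sum-cong at-vertex) ⟩
        μ * fibre-sum x₀ (γ x₀)     ≈⟨ *-congˡ (proj₂ γ-cochain x₀ (vertices X (U y₀)) (∣⁅x⁆∣≡1 (U y₀))) ⟩
        μ * 0#                      ≈⟨ zeroʳ μ ⟩
        0#                          ∎
        where
        at-vertex : ∀ y → (if over x₀ y then c₀ else 0#) ≈ (if over x₀ y then γ x₀ y else 0#)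
        at-vertex y with over x₀ y in y-over
        ... | true  = ≈.sym (on-vertex x₀ y y-over (∣⁅x⁆∣≡1 (U y₀)))
        ... | false = ≈.refl
      outside-support : ∀ x j → ¬ T (⌊ ∣ x ∣ Nat.≟ 1 ⌋ ∧ over x j) → γ x j ≈ 0#
      outside-support x j ns = proj₁ γ-cochain x j (λ t → ns (proj₂ (T-∧⁻ {isFace X x} t)))
      vanishes : ∀ x j → γ x j ≈ 0#
      vanishes x j with over x j in j-over
      ... | false = outside-support x j (λ t → false≢true (≡.trans (≡.sym j-over) (T⇒≡true (proj₂ (T-∧⁻ {⌊ ∣ x ∣ Nat.≟ 1 ⌋} t)))))
      ... | true with ∣ x ∣ Nat.≟ 1
      ...   | yes size = ≈.trans (on-vertex x j j-over size) c₀≈0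
      ...   | no ¬size = outside-support x j (λ t → ¬size (⌊⌋-sound (T⇒≡true (proj₁ (T-∧⁻ {⌊ ∣ x ∣ Nat.≟ 1 ⌋} t)))))

    h⁰-kernel : Connected Y → HasH G 0 0
    h⁰-kernel connected = (λ ()) , (λ ()) , (λ _ _ ()) , λ v v-cocycle →
      (λ ()) , (λ _ _ → 0#) , isCochain-0 G G-stalks 0 , λ x j →
        ≈.trans (δ-0 G (λ _ _ → 0#) (λ _ _ → ≈.refl) x j)
                (≈.sym (≈.trans (+-cong (kernel-cocycle⁰-vanishes connected (curry v) v-cocycle x j) -0#≈0#) (+-identityˡ 0#)))

    h¹-kernel+h¹-X≡h¹-Y : ∀ {g hY hX} → HasH G 1 g → HasH CY 1 hY → HasH CX 1 hX → g +ℕ hX ≡ hY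
    h¹-kernel+h¹-X≡h¹-Y hG hY hX =
      quotDim-unique (coboundaries CY CY-stalks 1) (H-pushforward⇒H-Y 1 (DirectSum.hasDim-+ (splitting 1) hG hX)) hY

open Nat using (_+_)

lemma14p1 : {c ℓ : Level} (F : Field c ℓ) (Y X : SimplicialComplex)
    (cov : Covering Y X) (m : ℕ) →
    HasDegree cov m → Connected Y → Connected X →
    ¬ (Field._≈_ F (LinAlg.ι F m) (Field.0# F)) →
    Cohomology.HasH F (Cohomology.kerSheaf F cov) 0 0
    × (∀ g hY hX →
         Cohomology.HasH F (Cohomology.kerSheaf F cov) 1 g →
         Cohomology.HasH F (Cohomology.constSheaf F Y) 1 hY →
         Cohomology.HasH F (Cohomology.constSheaf F X) 1 hX →
         g + hX ≡ hY)
lemma14p1 F Y X cov m deg connected-Y _ m≉0 =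
  h⁰-kernel connected-Y , λ g hY hX → h¹-kernel+h¹-X≡h¹-Y
  where open Pushforward.Transfer F cov m deg m≉0
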